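{- For $L$ and $M$ being non-negative integers, we have \begin{equation*} \sum_{\substack{m\geq 0,\\ L\equiv m \text{ (mod 2)}}} q^{m^2}{3M \brack m}_{q^2} {2M + \frac{L-m}{2}\brack 2M}_{q^6} = \sum_{j=-\infty}^{\infty} q^{3j^2+2j}\, \mathcal{T}\left(L,M;\,j,j;\,q^6\right). \end{equation*}
   Context: Here $|q|<1$, $(a;q)_n=(1-a)(1-aq)\cdots(1-aq^{n-1})$, and the $q$-binomial coefficient ${m+n \brack m}_q = \frac{(q;q)_{m+n}}{(q;q)_m(q;q)_n}$ for $m,n\geq 0$ and $0$ otherwise. The refined $q$-trinomial coefficient (Warnaar) is \[\mathcal{T}(L,M;\,a,b;\,q) := \sum_{\substack{n\geq0, \\ L-a\equiv n \text{ (mod 2)}}} q^{\frac{n^2}{2}} {M\brack n}_q {M+b+\frac{L-a-n}{2} \brack M+b}_q {M-b +\frac{L+a-n}{2}\brack M-b}_q.\] -}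

module Defs where

open import Level using (Level)
open import Algebra.Bundles using (CommutativeRing)
open import Data.Nat as ℕ using (ℕ; zero; suc)
open import Data.Integer as ℤ using (ℤ; +_; -[1+_]; ∣_∣)
open import Data.Bool using (Bool; true; false; if_then_else_)

evenℕ : ℕ → Bool
evenℕ zero = true
evenℕ (suc zero) = false
evenℕ (suc (suc n)) = evenℕ n

evenℤ : ℤ → Bool
evenℤ z = evenℕ ∣ z ∣

-- exact half of an even integer (only ever used on even arguments)
halfℤ : ℤ → ℤ
halfℤ (+ n) = + ℕ.⌊ n /2⌋
halfℤ (-[1+ n ]) = ℤ.- (+ ℕ.⌊ suc n /2⌋)

module _ {c ℓ : Level} (R : CommutativeRing c ℓ) where
  open CommutativeRing R using (Carrier; _+_; _*_; 0#; 1#)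

  pow : Carrier → ℕ → Carrier
  pow x zero = 1#
  pow x (suc n) = x * pow x n

  gauss : Carrier → ℕ → ℕ → Carrier
  gauss q n zero = 1#
  gauss q zero (suc k) = 0#
  gauss q (suc n) (suc k) = gauss q n k + pow q (suc k) * gauss q n (suc k)

  -- the paper's  [ m+n ; m ]_q  for integers m, n : zero unless m, n ≥ 0
  qbin : Carrier → ℤ → ℤ → Carrier
  qbin q (+ m) (+ n) = gauss q (m ℕ.+ n) m
  qbin q (+ m) -[1+ n ] = 0#
  qbin q -[1+ m ] n = 0#

  sumTo : ℕ → (ℕ → Carrier) → Carrier
  sumTo zero f = f zero
  sumTo (suc N) f = sumTo N f + f (suc N)

  sumSym : ℕ → (ℤ → Carrier) → Carrier
  sumSym zero f = f (+ 0)
  sumSym (suc K) f = sumSym K f + f (+ suc K) + f -[1+ K ]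

  -- Warnaar's refined q-trinomial coefficient T(L,M;a,b;q) with q = r²
  -- (r plays the role of q^(1/2), so q^(n²/2) = r^(n²)).
  -- The n-sum runs over 0 ≤ n ≤ M; terms with n > M vanish since [M ; n]_q = 0.
  refinedTrinomial : ℕ → ℕ → ℤ → ℤ → Carrier → Carrier
  refinedTrinomial L M a b r =
    sumTo M λ n →
      if evenℤ ((+ L) ℤ.- a ℤ.- (+ n))
      then pow r (n ℕ.* n)
           * gauss (r * r) M n
           * qbin (r * r) ((+ M) ℤ.+ b) (halfℤ ((+ L) ℤ.- a ℤ.- (+ n)))
           * qbin (r * r) ((+ M) ℤ.- b) (halfℤ ((+ L) ℤ.+ a ℤ.- (+ n)))
      else 0#

  -- left-hand side; m-sum truncated at m ≤ L (for m > L, (L-m)/2 < 0 so the term is 0)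
  lhs1p2 : ℕ → ℕ → Carrier → Carrier
  lhs1p2 L M q =
    sumTo L λ m →
      if evenℤ ((+ L) ℤ.- (+ m))
      then pow q (m ℕ.* m)
           * gauss (pow q 2) (3 ℕ.* M) m
           * qbin (pow q 6) (+ (2 ℕ.* M)) (halfℤ ((+ L) ℤ.- (+ m)))
      else 0#

  -- right-hand side; j-sum truncated at |j| ≤ L + M
  -- (T(L,M;j,j) = 0 for |j| > M since then M+j < 0 or M-j < 0)
  rhs1p2 : ℕ → ℕ → Carrier → Carrier
  rhs1p2 L M q =
    sumSym (L ℕ.+ M) λ j →
      pow q ∣ (+ 3) ℤ.* j ℤ.* j ℤ.+ (+ 2) ℤ.* j ∣
      * refinedTrinomial L M j j (pow q 3)

module Submission where

-- Both sides of the identity are read as the coefficient of z^L in one formal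
-- power series in an auxiliary variable z, with coefficients in an arbitrary
-- commutative ring:
--   product = P 3 · P 1 · P 5 · ρ(z²),   P r = ∏_{i<M} (1 + z q^(r+6i)),
--   ρ(z) = Σ_k [2M+k; k]_{q⁶} z^k.
-- Left-hand side: q^(m²) [3M; m]_{q²} are the coefficients of
-- ∏_{i<3M} (1 + z q^(2i+1)) (q-binomial theorem), and grouping i by its residue
-- mod 3 splits this product into P 1 · P 3 · P 5.
-- Right-hand side: after exchanging the j- and n-sums, the n-sum becomes the
-- coefficients of P 3 against D(z) = Σ_{u,v} q^(3j²+2j) [M+v; u][M+u; v]_{q⁶} z^(u+v),
-- j = v - u (only j ≡ L - n mod 2 survive).  The product formula
--   [M+v; u][N+u; v] = Σ_k Q^((u-k)(v-k)) [M; u-k][N; v-k][M+N+k; k]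
-- identifies D with P 1 · P 5 · ρ(z²).

open import Defs
open import Algebra.Bundles using (CommutativeRing)
open import Data.Nat using (ℕ)
open import Data.Nat as ℕ using (zero; suc)
import Data.Nat.Properties as ℕP
open import Data.Nat.Tactic.RingSolver using (solve-∀)
open import Data.Integer as ℤ using (ℤ; +_; -[1+_]; _⊖_)
import Data.Integer.Properties as ℤP
import Data.Integer.Tactic.RingSolver as ℤSolver
open import Data.Bool using (Bool; true; false; if_then_else_)
open import Data.Product using (_×_; _,_; ∃; proj₁; proj₂)
open import Data.Sum using (inj₁; inj₂)
open import Relation.Binary.PropositionalEquality as ≡ using (_≡_)
open import Relation.Binary.Definitions using (tri<; tri≈; tri>)

module Arithmetic where
  open import Data.Nat using (_+_; _*_; _∸_; ⌊_/2⌋; _≤_)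

  even-double : ∀ u → evenℕ (u + u) ≡ true
  even-double zero = ≡.refl
  even-double (suc u) rewrite ℕP.+-suc u u = even-double u

  half-double : ∀ u → ⌊ u + u /2⌋ ≡ u
  half-double zero = ≡.refl
  half-double (suc u) rewrite ℕP.+-suc u u = ≡.cong suc (half-double u)

  even-double+ : ∀ k m → evenℕ (k + k + m) ≡ evenℕ m
  even-double+ zero m = ≡.refl
  even-double+ (suc k) m rewrite ℕP.+-suc k k = even-double+ k m

  even-odd : ∀ k → evenℕ (k + suc k) ≡ false
  even-odd zero = ≡.refl
  even-odd (suc k) rewrite ℕP.+-suc k (suc k) = even-odd k

  even-⊖ : ∀ k m → evenℕ ℤ.∣ k ⊖ m ∣ ≡ evenℕ (k + m)
  even-⊖ zero zero = ≡.refl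
  even-⊖ zero (suc m) = ≡.refl
  even-⊖ (suc k) zero = ≡.cong evenℕ (≡.sym (ℕP.+-identityʳ (suc k)))
  even-⊖ (suc k) (suc m) = begin
    evenℕ ℤ.∣ suc k ⊖ suc m ∣ ≡⟨ ≡.cong (λ z → evenℕ ℤ.∣ z ∣) (ℤP.[1+m]⊖[1+n]≡m⊖n k m) ⟩
    evenℕ ℤ.∣ k ⊖ m ∣         ≡⟨ even-⊖ k m ⟩
    evenℕ (k + m)             ≡⟨ ≡.cong (λ n → evenℕ (suc n)) (≡.sym (ℕP.+-suc k m)) ⟩
    evenℕ (suc k + suc m)     ∎
    where open ≡.≡-Reasoning

  ⊖-below : ∀ k d → k ⊖ suc (k + d) ≡ -[1+ d ]
  ⊖-below zero d = ≡.refl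
  ⊖-below (suc k) d = ≡.trans (ℤP.[1+m]⊖[1+n]≡m⊖n k (suc (k + d))) (⊖-below k d)

  half-negative : ∀ d → evenℕ (suc d) ≡ true → ∃ λ e → halfℤ -[1+ d ] ≡ -[1+ e ]
  half-negative zero ()
  half-negative (suc d) _ = ⌊ d /2⌋ , ≡.refl

  +-∸ : ∀ a b → b ≤ a → + a ℤ.- + b ≡ + (a ∸ b)
  +-∸ a b b≤a = ≡.trans (ℤP.m-n≡m⊖n a b) (ℤP.⊖-≥ b≤a)

  +-suc-suc : ∀ a u → + suc a ℤ.- + suc u ≡ + a ℤ.- + u
  +-suc-suc a u = begin
    + suc a ℤ.- + suc u ≡⟨ ℤP.m-n≡m⊖n (suc a) (suc u) ⟩
    suc a ⊖ suc u       ≡⟨ ℤP.[1+m]⊖[1+n]≡m⊖n a u ⟩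
    a ⊖ u               ≡⟨ ≡.sym (ℤP.m-n≡m⊖n a u) ⟩
    + a ℤ.- + u         ∎
    where open ≡.≡-Reasoning

  -- tri r k = Σ_{i<k} (r + 6i), the q-exponent of ∏_{i<k} q^(r+6i)
  tri : ℕ → ℕ → ℕ
  tri r zero = 0
  tri r (suc k) = r + 6 * k + tri r k

  tri3 : ∀ n → tri 3 n ≡ 3 * (n * n)
  tri3 zero = ≡.refl
  tri3 (suc n) = ≡.trans (≡.cong (λ t → 3 + 6 * n + t) (tri3 n)) (step n)
    where step : ∀ n → 3 + 6 * n + 3 * (n * n) ≡ 3 * ((1 + n) * (1 + n))
          step = solve-∀

  tri5 : ∀ n → tri 5 n ≡ 3 * n * n + 2 * n
  tri5 zero = ≡.refl
  tri5 (suc n) = ≡.trans (≡.cong (λ t → 5 + 6 * n + t) (tri5 n)) (step n)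
    where step : ∀ n → 5 + 6 * n + (3 * n * n + 2 * n) ≡ 3 * (1 + n) * (1 + n) + 2 * (1 + n)
          step = solve-∀

  tri1 : ∀ n → tri 1 n + 2 * n ≡ 3 * n * n
  tri1 zero = ≡.refl
  tri1 (suc n) = begin
    (1 + 6 * n + tri 1 n) + 2 * (1 + n) ≡⟨ regroup (tri 1 n) n ⟩
    (tri 1 n + 2 * n) + (3 + 6 * n)     ≡⟨ ≡.cong (_+ (3 + 6 * n)) (tri1 n) ⟩
    3 * n * n + (3 + 6 * n)             ≡⟨ square n ⟩
    3 * (1 + n) * (1 + n)               ∎
    where
    open ≡.≡-Reasoning
    regroup : ∀ t n → (1 + 6 * n + t) + 2 * (1 + n) ≡ (t + 2 * n) + (3 + 6 * n)
    regroup = solve-∀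
    square : ∀ n → 3 * n * n + (3 + 6 * n) ≡ 3 * (1 + n) * (1 + n)
    square = solve-∀

  -- the exponent 3j² + 2j for j = v - u, defined by recursion on (u, v);
  -- it only depends on v - u
  weight : ℕ → ℕ → ℕ
  weight zero v = tri 5 v
  weight (suc u) zero = tri 1 (suc u)
  weight (suc u) (suc v) = weight u v

  weight-split : ∀ a b → weight a b + 6 * (a * b) ≡ tri 1 a + tri 5 b
  weight-split zero b = ℕP.+-identityʳ (tri 5 b)
  weight-split (suc a) zero = ≡.cong (λ t → tri 1 (suc a) + t) (≡.cong (6 *_) (ℕP.*-zeroʳ (suc a)))
  weight-split (suc a) (suc b) = begin
    weight a b + 6 * ((1 + a) * (1 + b))           ≡⟨ expand (weight a b) a b ⟩
    (weight a b + 6 * (a * b)) + (6 + 6 * a + 6 * b) ≡⟨ ≡.cong (_+ (6 + 6 * a + 6 * b)) (weight-split a b) ⟩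
    (tri 1 a + tri 5 b) + (6 + 6 * a + 6 * b)       ≡⟨ regroup (tri 1 a) (tri 5 b) a b ⟩
    tri 1 (suc a) + tri 5 (suc b)                   ∎
    where
    open ≡.≡-Reasoning
    expand : ∀ w a b → w + 6 * ((1 + a) * (1 + b)) ≡ (w + 6 * (a * b)) + (6 + 6 * a + 6 * b)
    expand = solve-∀
    regroup : ∀ x y a b → (x + y) + (6 + 6 * a + 6 * b) ≡ (1 + 6 * a + x) + (5 + 6 * b + y)
    regroup = solve-∀

  pos-quadratic : ∀ a b → + (3 * a * a + b * a) ≡ + 3 ℤ.* + a ℤ.* + a ℤ.+ + b ℤ.* + a
  pos-quadratic a b = ≡.trans (ℤP.pos-+ (3 * a * a) (b * a))
    (≡.cong₂ ℤ._+_ (≡.trans (ℤP.pos-* (3 * a) a) (≡.cong (ℤ._* + a) (ℤP.pos-* 3 a))) (ℤP.pos-* b a))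

  weight-abs : ∀ u v → let j = + v ℤ.- + u in ℤ.∣ + 3 ℤ.* j ℤ.* j ℤ.+ + 2 ℤ.* j ∣ ≡ weight u v
  weight-abs zero v = begin
    ℤ.∣ + 3 ℤ.* (+ v ℤ.- + 0) ℤ.* (+ v ℤ.- + 0) ℤ.+ + 2 ℤ.* (+ v ℤ.- + 0) ∣
      ≡⟨ ≡.cong (λ j → ℤ.∣ + 3 ℤ.* j ℤ.* j ℤ.+ + 2 ℤ.* j ∣) (ℤP.+-identityʳ (+ v)) ⟩
    ℤ.∣ + 3 ℤ.* + v ℤ.* + v ℤ.+ + 2 ℤ.* + v ∣ ≡⟨ ≡.cong ℤ.∣_∣ (≡.sym (pos-quadratic v 2)) ⟩
    3 * v * v + 2 * v                         ≡⟨ ≡.sym (tri5 v) ⟩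
    tri 5 v                                   ∎
    where open ≡.≡-Reasoning
  weight-abs (suc u) zero = ≡.cong ℤ.∣_∣ (begin
    + 3 ℤ.* ℤ.- x ℤ.* ℤ.- x ℤ.+ + 2 ℤ.* ℤ.- x ≡⟨ negate x ⟩
    + 3 ℤ.* x ℤ.* x ℤ.- + 2 ℤ.* x           ≡⟨ ≡.cong (ℤ._- + 2 ℤ.* x) (≡.sym sum) ⟩
    + t ℤ.+ + 2 ℤ.* x ℤ.- + 2 ℤ.* x         ≡⟨ cancel (+ t) x ⟩
    + t                                     ∎)
    where
    open ≡.≡-Reasoning
    x = + suc u
    t = tri 1 (suc u)
    sum : + t ℤ.+ + 2 ℤ.* x ≡ + 3 ℤ.* x ℤ.* x
    sum = ≡.trans (≡.trans (≡.cong (λ z → + t ℤ.+ z) (≡.sym (ℤP.pos-* 2 (suc u)))) (≡.sym (ℤP.pos-+ t (2 * suc u))))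
          (≡.trans (≡.cong +_ (tri1 (suc u))) (≡.trans (ℤP.pos-* (3 * suc u) (suc u)) (≡.cong (ℤ._* x) (ℤP.pos-* 3 (suc u)))))
    negate : ∀ x → + 3 ℤ.* ℤ.- x ℤ.* ℤ.- x ℤ.+ + 2 ℤ.* ℤ.- x ≡ + 3 ℤ.* x ℤ.* x ℤ.- + 2 ℤ.* x
    negate = ℤSolver.solve-∀
    cancel : ∀ t x → t ℤ.+ + 2 ℤ.* x ℤ.- + 2 ℤ.* x ≡ t
    cancel = ℤSolver.solve-∀
  weight-abs (suc u) (suc v) =
    ≡.trans (≡.cong (λ j → ℤ.∣ + 3 ℤ.* j ℤ.* j ℤ.+ + 2 ℤ.* j ∣) (+-suc-suc v u)) (weight-abs u v)

module _ {c ℓ} (R : CommutativeRing c ℓ) where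
  open CommutativeRing R hiding (zero)
  open import Algebra.Solver.Ring.NaturalCoefficients.Default commutativeSemiring
  open import Relation.Binary.Reasoning.Setoid setoid
  open import Algebra.Properties.CommutativeSemigroup +-commutativeSemigroup using (interchange)

  infixr 8 _^_
  _^_ : Carrier → ℕ → Carrier
  _^_ = pow R

  G : Carrier → ℕ → ℕ → Carrier
  G = gauss R

  *-vanishʳ : ∀ {x y} → y ≈ 0# → x * y ≈ 0#
  *-vanishʳ {x} y≈0 = trans (*-congˡ y≈0) (zeroʳ x)

  *-vanishˡ : ∀ {x y} → x ≈ 0# → x * y ≈ 0#
  *-vanishˡ {_} {y} x≈0 = trans (*-congʳ x≈0) (zeroˡ y)

  +-vanish : ∀ {x y} → x ≈ 0# → y ≈ 0# → x + y ≈ 0#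
  +-vanish x≈0 y≈0 = trans (+-cong x≈0 y≈0) (+-identityʳ 0#)

  module Powers where
    ^-≡ : ∀ {x m n} → m ≡ n → x ^ m ≈ x ^ n
    ^-≡ ≡.refl = refl

    ^-cong : ∀ {x y} n → x ≈ y → x ^ n ≈ y ^ n
    ^-cong zero x≈y = refl
    ^-cong (suc n) x≈y = *-cong x≈y (^-cong n x≈y)

    ^-+ : ∀ x m n → x ^ (m ℕ.+ n) ≈ x ^ m * x ^ n
    ^-+ x zero n = sym (*-identityˡ _)
    ^-+ x (suc m) n = trans (*-congˡ (^-+ x m n)) (sym (*-assoc _ _ _))

    ^-* : ∀ x m n → x ^ (m ℕ.* n) ≈ (x ^ m) ^ n
    ^-* x m zero = ^-≡ (ℕP.*-zeroʳ m)
    ^-* x m (suc n) = begin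
      x ^ (m ℕ.* suc n)      ≈⟨ ^-≡ (ℕP.*-suc m n) ⟩
      x ^ (m ℕ.+ m ℕ.* n)    ≈⟨ ^-+ x m (m ℕ.* n) ⟩
      x ^ m * x ^ (m ℕ.* n)  ≈⟨ *-congˡ (^-* x m n) ⟩
      x ^ m * (x ^ m) ^ n    ∎

    ^-affine : ∀ x a d k → x ^ a * (x ^ d) ^ k ≈ x ^ (a ℕ.+ d ℕ.* k)
    ^-affine x a d k = sym (trans (^-+ x a (d ℕ.* k)) (*-congˡ (^-* x d k)))
  open Powers

  module Gaussian where
    G-≡ : ∀ {Q n m} k → n ≡ m → G Q n k ≈ G Q m k
    G-≡ k ≡.refl = refl

    G-cong : ∀ {x y} n k → x ≈ y → G x n k ≈ G y n k
    G-cong n zero x≈y = refl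
    G-cong zero (suc k) x≈y = refl
    G-cong (suc n) (suc k) x≈y = +-cong (G-cong n k x≈y) (*-cong (^-cong (suc k) x≈y) (G-cong n (suc k) x≈y))

    G-vanish : ∀ Q n k → n ℕ.< k → G Q n k ≈ 0#
    G-vanish Q zero (suc k) _ = refl
    G-vanish Q (suc n) (suc k) (ℕ.s≤s n<k) =
      +-vanish (G-vanish Q n k n<k) (*-vanishʳ (G-vanish Q n (suc k) (ℕP.m≤n⇒m≤1+n n<k)))

    G-diag : ∀ Q n → G Q n n ≈ 1#
    G-diag Q zero = refl
    G-diag Q (suc n) = trans (+-cong (G-diag Q n) (*-vanishʳ (G-vanish Q n (suc n) ℕP.≤-refl))) (+-identityʳ 1#)

    -- second Pascal rule, multiplied by Q^k so that no subtraction of indices occurs: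
    --   Q^k [n+1; k+1] = Q^k [n; k+1] + Q^n [n; k]
    pascal₂ : ∀ Q n k → Q ^ k * G Q (suc n) (suc k) ≈ Q ^ k * G Q n (suc k) + Q ^ n * G Q n k
    pascal₂ Q zero zero = begin
      1# * (1# + Q ^ 1 * 0#) ≈⟨ *-identityˡ _ ⟩
      1# + Q ^ 1 * 0#        ≈⟨ +-congˡ (zeroʳ _) ⟩
      1# + 0#                ≈⟨ +-comm _ _ ⟩
      0# + 1#                ≈⟨ +-cong (sym (zeroʳ 1#)) (sym (*-identityˡ 1#)) ⟩
      1# * 0# + 1# * 1#      ∎
    pascal₂ Q zero (suc k) = trans (*-vanishʳ (+-vanish refl (zeroʳ _))) (sym (+-vanish (zeroʳ _) (zeroʳ _)))
    pascal₂ Q (suc n) zero = begin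
      1# * (1# + Q ^ 1 * G Q (suc n) 1)    ≈⟨ *-identityˡ _ ⟩
      1# + Q ^ 1 * G Q (suc n) 1           ≈⟨ +-congˡ (*-congˡ (trans (sym (*-identityˡ _)) (pascal₂ Q n 0))) ⟩
      1# + Q ^ 1 * (1# * G Q n 1 + Q ^ n * 1#)
        ≈⟨ solve 3 (λ q g p → con 1 :+ q :* (con 1 :* g :+ p :* con 1) := con 1 :* (con 1 :+ q :* g) :+ (q :* p) :* con 1)
                   refl (Q ^ 1) (G Q n 1) (Q ^ n) ⟩
      1# * (1# + Q ^ 1 * G Q n 1) + (Q ^ 1 * Q ^ n) * 1#
        ≈⟨ +-congˡ (*-congʳ (*-congʳ (*-identityʳ Q))) ⟩
      1# * G Q (suc n) 1 + Q ^ suc n * 1#  ∎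
    pascal₂ Q (suc n) (suc k) = begin
      q * a * (G Q (suc n) (suc k) + q * (q * a) * G Q (suc n) (suc (suc k)))
        ≈⟨ solve 4 (λ q a x y → (q :* a) :* (x :+ (q :* (q :* a)) :* y) := q :* (a :* x) :+ (q :* (q :* a)) :* ((q :* a) :* y))
                   refl q a (G Q (suc n) (suc k)) (G Q (suc n) (suc (suc k))) ⟩
      q * (a * G Q (suc n) (suc k)) + (q * (q * a)) * (q * a * G Q (suc n) (suc (suc k)))
        ≈⟨ +-cong (*-congˡ (pascal₂ Q n k)) (*-congˡ (pascal₂ Q n (suc k))) ⟩
      q * (a * g₁ + m * g₀) + (q * (q * a)) * ((q * a) * g₂ + m * g₁)
        ≈⟨ solve 6 (λ q a m g₀ g₁ g₂ → q :* (a :* g₁ :+ m :* g₀) :+ (q :* (q :* a)) :* ((q :* a) :* g₂ :+ m :* g₁)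
                                      := (q :* a) :* (g₁ :+ (q :* (q :* a)) :* g₂) :+ (q :* m) :* (g₀ :+ (q :* a) :* g₁))
                   refl q a m g₀ g₁ g₂ ⟩
      q * a * (g₁ + q * (q * a) * g₂) + q * m * (g₀ + q * a * g₁) ∎
      where q = Q
            a = Q ^ k
            m = Q ^ n
            g₀ = G Q n k
            g₁ = G Q n (suc k)
            g₂ = G Q n (suc (suc k))

    -- B Q a b = [a+b; a]_Q, the coordinates in which both Pascal rules and symmetry are stated
    B : Carrier → ℕ → ℕ → Carrier
    B Q a b = G Q (a ℕ.+ b) a

    B-right0 : ∀ Q a → B Q a 0 ≈ 1#
    B-right0 Q a = trans (G-≡ a (ℕP.+-identityʳ a)) (G-diag Q a)

    pascalB₁ : ∀ Q a b → B Q (suc a) (suc b) ≈ B Q a (suc b) + Q ^ suc a * B Q (suc a) b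
    pascalB₁ Q a b = +-congˡ (*-congˡ (G-≡ (suc a) (ℕP.+-suc a b)))

    pascalB₂-base : ∀ Q b → 1# + Q ^ 1 * B Q 1 b ≈ Q ^ suc b * 1# + B Q 1 b
    pascalB₂-base Q zero = begin
      1# + Q ^ 1 * B Q 1 0  ≈⟨ +-congˡ (*-congˡ (B-right0 Q 1)) ⟩
      1# + Q ^ 1 * 1#       ≈⟨ +-comm _ _ ⟩
      Q ^ 1 * 1# + 1#       ≈⟨ +-congˡ (sym (B-right0 Q 1)) ⟩
      Q ^ 1 * 1# + B Q 1 0  ∎
    pascalB₂-base Q (suc b) = begin
      1# + Q ^ 1 * B Q 1 (suc b)                 ≈⟨ +-congˡ (*-congˡ B₁) ⟩
      1# + Q ^ 1 * (1# + Q ^ 1 * B Q 1 b)        ≈⟨ +-congˡ (*-congˡ (pascalB₂-base Q b)) ⟩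
      1# + Q ^ 1 * (Q ^ suc b * 1# + B Q 1 b)
        ≈⟨ solve 3 (λ q p x → con 1 :+ q :* (p :* con 1 :+ x) := (q :* p) :* con 1 :+ (con 1 :+ q :* x)) refl (Q ^ 1) (Q ^ suc b) (B Q 1 b) ⟩
      Q ^ 1 * Q ^ suc b * 1# + (1# + Q ^ 1 * B Q 1 b) ≈⟨ +-cong (*-congʳ (*-congʳ (*-identityʳ Q))) (sym B₁) ⟩
      Q ^ suc (suc b) * 1# + B Q 1 (suc b)       ∎
      where B₁ = pascalB₁ Q 0 b

    pascalB₂ : ∀ Q a b → B Q (suc a) (suc b) ≈ Q ^ suc b * B Q a (suc b) + B Q (suc a) b
    pascalB₂ Q zero b = trans (pascalB₁ Q 0 b) (pascalB₂-base Q b)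
    pascalB₂ Q (suc a) zero = begin
      B Q (suc (suc a)) 1                                ≈⟨ pascalB₁ Q (suc a) 0 ⟩
      y + Q ^ suc (suc a) * B Q (suc (suc a)) 0          ≈⟨ +-cong (pascalB₂ Q a 0) (*-congˡ (B-right0 Q (suc (suc a)))) ⟩
      (Q ^ 1 * x + B Q (suc a) 0) + Q * Q ^ suc a * 1#   ≈⟨ +-congʳ (+-cong (*-congʳ (*-identityʳ Q)) (B-right0 Q (suc a))) ⟩
      (Q * x + 1#) + Q * Q ^ suc a * 1#
        ≈⟨ solve 3 (λ q x s → (q :* x :+ con 1) :+ q :* s :* con 1 := q :* (x :+ s :* con 1) :+ con 1) refl Q x (Q ^ suc a) ⟩
      Q * (x + Q ^ suc a * 1#) + 1#
        ≈⟨ +-cong (*-cong (sym (*-identityʳ Q)) (sym (trans (pascalB₁ Q a 0) (+-congˡ (*-congˡ (B-right0 Q (suc a)))))))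
                  (sym (B-right0 Q (suc (suc a)))) ⟩
      Q ^ 1 * y + B Q (suc (suc a)) 0                    ∎
      where x = B Q a 1
            y = B Q (suc a) 1
    pascalB₂ Q (suc a) (suc b) = begin
      B Q (suc (suc a)) (suc (suc b))                    ≈⟨ pascalB₁ Q (suc a) (suc b) ⟩
      B Q (suc a) (suc (suc b)) + qa₂ * B Q (suc (suc a)) (suc b)
        ≈⟨ +-cong (pascalB₂ Q a (suc b)) (*-congˡ (pascalB₂ Q (suc a) b)) ⟩
      (qb₂ * x + y) + qa₂ * (qb₁ * y + w)
        ≈⟨ solve 6 (λ q qa qb x y w → (q :* qb :* x :+ y) :+ (q :* qa) :* (qb :* y :+ w)
                                     := (q :* qb) :* (x :+ qa :* y) :+ (y :+ (q :* qa) :* w))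
                   refl Q qa₁ qb₁ x y w ⟩
      qb₂ * (x + qa₁ * y) + (y + qa₂ * w)                ≈⟨ +-cong (*-congˡ (sym (pascalB₁ Q a (suc b)))) (sym (pascalB₁ Q (suc a) b)) ⟩
      qb₂ * B Q (suc a) (suc (suc b)) + B Q (suc (suc a)) (suc b) ∎
      where qa₁ = Q ^ suc a
            qa₂ = Q ^ suc (suc a)
            qb₁ = Q ^ suc b
            qb₂ = Q ^ suc (suc b)
            x = B Q a (suc (suc b))
            y = B Q (suc a) (suc b)
            w = B Q (suc (suc a)) b

    -- both Pascal rules together give symmetry, by induction on a and b
    B-sym : ∀ Q a b → B Q a b ≈ B Q b a
    B-sym Q zero b = sym (B-right0 Q b)
    B-sym Q (suc a) zero = B-right0 Q (suc a)
    B-sym Q (suc a) (suc b) = begin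
      B Q (suc a) (suc b)                              ≈⟨ pascalB₁ Q a b ⟩
      B Q a (suc b) + Q ^ suc a * B Q (suc a) b        ≈⟨ +-cong (B-sym Q a (suc b)) (*-congˡ (B-sym Q (suc a) b)) ⟩
      B Q (suc b) a + Q ^ suc a * B Q b (suc a)        ≈⟨ +-comm _ _ ⟩
      Q ^ suc a * B Q b (suc a) + B Q (suc b) a        ≈⟨ sym (pascalB₂ Q b a) ⟩
      B Q (suc b) (suc a)                              ∎

    G-sym : ∀ Q a b → G Q (a ℕ.+ b) a ≈ G Q (a ℕ.+ b) b
    G-sym Q a b = trans (B-sym Q a b) (G-≡ b (ℕP.+-comm b a))
  open Gaussian

  -- Sums along a diagonal of a three-index family:
  --   diag f u v = Σ_{k ≤ min(u,v)} f (u-k) (v-k) k,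
  -- the shape of the right-hand side of the product formula below.
  module DiagonalSums where
    Family : Set c
    Family = ℕ → ℕ → ℕ → Carrier

    shiftK : Family → Family
    shiftK f a b k = f a b (suc k)

    diag : Family → ℕ → ℕ → Carrier
    diag f zero v = f zero v 0
    diag f (suc u) zero = f (suc u) zero 0
    diag f (suc u) (suc v) = f (suc u) (suc v) 0 + diag (shiftK f) u v

    diag-right0 : ∀ f u → diag f u 0 ≈ f u 0 0
    diag-right0 f zero = refl
    diag-right0 f (suc u) = refl

    diag-cong : ∀ {f g} → (∀ a b k → f a b k ≈ g a b k) → ∀ u v → diag f u v ≈ diag g u v
    diag-cong f≈g zero v = f≈g _ _ _
    diag-cong f≈g (suc u) zero = f≈g _ _ _
    diag-cong f≈g (suc u) (suc v) = +-cong (f≈g _ _ _) (diag-cong (λ a b k → f≈g a b (suc k)) u v)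

    diag-+ : ∀ f g u v → diag (λ a b k → f a b k + g a b k) u v ≈ diag f u v + diag g u v
    diag-+ f g zero v = refl
    diag-+ f g (suc u) zero = refl
    diag-+ f g (suc u) (suc v) = trans (+-congˡ (diag-+ (shiftK f) (shiftK g) u v)) (interchange _ _ _ _)

    diag-*ˡ : ∀ x f u v → x * diag f u v ≈ diag (λ a b k → x * f a b k) u v
    diag-*ˡ x f zero v = refl
    diag-*ˡ x f (suc u) zero = refl
    diag-*ˡ x f (suc u) (suc v) = trans (distribˡ _ _ _) (+-congˡ (diag-*ˡ x (shiftK f) u v))

    -- a weight depending only on v - u can be moved inside the diagonal sum
    diag-weight : ∀ (w : ℕ → ℕ → Carrier) → (∀ u v → w (suc u) (suc v) ≈ w u v) → ∀ f u v →
                  w u v * diag f u v ≈ diag (λ a b k → w a b * f a b k) u v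
    diag-weight w w-diag f zero v = refl
    diag-weight w w-diag f (suc u) zero = refl
    diag-weight w w-diag f (suc u) (suc v) =
      trans (distribˡ _ _ _) (+-congˡ (trans (*-congʳ (w-diag u v)) (diag-weight w w-diag (shiftK f) u v)))

    diag-scale : ∀ x f u v → x ^ u * diag f u v ≈ diag (λ a b k → x ^ (a ℕ.+ k) * f a b k) u v
    diag-scale x f zero v = refl
    diag-scale x f (suc u) zero = *-congʳ (^-≡ (≡.sym (ℕP.+-identityʳ (suc u))))
    diag-scale x f (suc u) (suc v) = begin
      x ^ suc u * (f (suc u) (suc v) 0 + diag (shiftK f) u v)
        ≈⟨ distribˡ _ _ _ ⟩
      x ^ suc u * f (suc u) (suc v) 0 + x * x ^ u * diag (shiftK f) u v
        ≈⟨ +-cong (*-congʳ (^-≡ (≡.sym (ℕP.+-identityʳ (suc u))))) (*-assoc _ _ _) ⟩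
      x ^ (suc u ℕ.+ 0) * f (suc u) (suc v) 0 + x * (x ^ u * diag (shiftK f) u v)
        ≈⟨ +-congˡ (*-congˡ (diag-scale x (shiftK f) u v)) ⟩
      x ^ (suc u ℕ.+ 0) * f (suc u) (suc v) 0 + x * diag (λ a b k → x ^ (a ℕ.+ k) * f a b (suc k)) u v
        ≈⟨ +-congˡ (diag-*ˡ x _ u v) ⟩
      x ^ (suc u ℕ.+ 0) * f (suc u) (suc v) 0 + diag (λ a b k → x * (x ^ (a ℕ.+ k) * f a b (suc k))) u v
        ≈⟨ +-congˡ (diag-cong (λ a b k → trans (sym (*-assoc _ _ _)) (*-congʳ (^-≡ (≡.sym (ℕP.+-suc a k))))) u v) ⟩
      x ^ (suc u ℕ.+ 0) * f (suc u) (suc v) 0 + diag (λ a b k → x ^ (a ℕ.+ suc k) * f a b (suc k)) u v ∎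

    diag-split₁ : ∀ f g h → (∀ a b k → f (suc a) b k ≈ g a b k + h (suc a) b k) → (∀ b k → f 0 b k ≈ h 0 b k) →
                  ∀ u v → diag f (suc u) v ≈ diag g u v + diag h (suc u) v
    diag-split₁ f g h split split0 u zero = trans (split _ _ _) (+-congʳ (sym (diag-right0 g u)))
    diag-split₁ f g h split split0 zero (suc v) = trans (+-cong (split _ _ _) (split0 _ _)) (+-assoc _ _ _)
    diag-split₁ f g h split split0 (suc u) (suc v) =
      trans (+-cong (split _ _ _) (diag-split₁ (shiftK f) (shiftK g) (shiftK h) (λ a b k → split a b (suc k)) (λ b k → split0 b (suc k)) u v))
            (interchange _ _ _ _)

    diag-split₂ : ∀ f g h → (∀ a b k → f a (suc b) k ≈ g a b k + h a (suc b) k) → (∀ a k → f a 0 k ≈ h a 0 k) →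
                  ∀ u v → diag f u (suc v) ≈ diag g u v + diag h u (suc v)
    diag-split₂ f g h split split0 zero v = split _ _ _
    diag-split₂ f g h split split0 (suc u) zero =
      trans (+-cong (split _ _ _) (trans (diag-right0 (shiftK f) u) (trans (split0 _ _) (sym (diag-right0 (shiftK h) u)))))
            (+-assoc _ _ _)
    diag-split₂ f g h split split0 (suc u) (suc v) =
      trans (+-cong (split _ _ _) (diag-split₂ (shiftK f) (shiftK g) (shiftK h) (λ a b k → split a b (suc k)) (λ a k → split0 a (suc k)) u v))
            (interchange _ _ _ _)

    diag-swap : ∀ f u v → diag f u v ≈ diag (λ a b k → f b a k) v u
    diag-swap f zero zero = refl
    diag-swap f zero (suc v) = refl
    diag-swap f (suc u) zero = refl
    diag-swap f (suc u) (suc v) = +-congˡ (diag-swap (shiftK f) u v)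

    δ₂ : ℕ → ℕ → Carrier
    δ₂ zero zero = 1#
    δ₂ zero (suc v) = 0#
    δ₂ (suc u) zero = 0#
    δ₂ (suc u) (suc v) = δ₂ u v

    diag-δ₂ : ∀ f → (∀ a b k → f (suc a) b k ≈ 0#) → (∀ a b k → f a (suc b) k ≈ 0#) → (∀ k → f 0 0 k ≈ 1#) →
              ∀ u v → diag f u v ≈ δ₂ u v
    diag-δ₂ f f₁ f₂ f₀ zero zero = f₀ 0
    diag-δ₂ f f₁ f₂ f₀ zero (suc v) = f₂ _ _ _
    diag-δ₂ f f₁ f₂ f₀ (suc u) zero = f₁ _ _ _
    diag-δ₂ f f₁ f₂ f₀ (suc u) (suc v) =
      trans (+-cong (f₁ _ _ _) (diag-δ₂ (shiftK f) (λ a b k → f₁ a b (suc k)) (λ a b k → f₂ a b (suc k)) (λ k → f₀ (suc k)) u v))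
            (+-identityˡ _)

    δ₂-< : ∀ u v → u ℕ.< v → δ₂ u v ≈ 0#
    δ₂-< zero (suc v) _ = refl
    δ₂-< (suc u) (suc v) (ℕ.s≤s u<v) = δ₂-< u v u<v

    δ₂-> : ∀ u v → v ℕ.< u → δ₂ u v ≈ 0#
    δ₂-> (suc u) zero _ = refl
    δ₂-> (suc u) (suc v) (ℕ.s≤s v<u) = δ₂-> u v v<u

    δ₂-diag : ∀ u → δ₂ u u ≈ 1#
    δ₂-diag zero = refl
    δ₂-diag (suc u) = δ₂-diag u

    G-transposed-product : ∀ Q u v → G Q v u * G Q u v ≈ δ₂ u v
    G-transposed-product Q u v with ℕP.<-cmp u v
    ... | tri< u<v _ _ = trans (*-vanishʳ (G-vanish Q u v u<v)) (sym (δ₂-< u v u<v))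
    ... | tri≈ _ ≡.refl _ = trans (*-cong (G-diag Q u) (G-diag Q u)) (trans (*-identityˡ 1#) (sym (δ₂-diag u)))
    ... | tri> _ _ v<u = trans (*-vanishˡ (G-vanish Q v u v<u)) (sym (δ₂-> u v v<u))
  open DiagonalSums

  -- The product formula
  --   [M+v; u] [N+u; v] = Σ_k Q^((u-k)(v-k)) [M; u-k] [N; v-k] [M+N+k; k].
  -- Both sides satisfy the same Pascal-type recurrence in (M, u) and, by the
  -- symmetry (M, u) ↔ (N, v), in (N, v); they agree when u = 0, when v = 0 and
  -- when M = N = 0 (both are then δ₂ u v).  Induction on M + N + u + v.
  module ProductFormula (Q : Carrier) where
    -- summand of the right-hand side; the top index n of the last factor is kept
    -- free because the recurrences change M + N only up to propositional equality
    term : ℕ → ℕ → ℕ → Family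
    term M N n a b k = Q ^ (a ℕ.* b) * G Q M a * G Q N b * G Q (n ℕ.+ k) k

    S : ℕ → ℕ → ℕ → ℕ → Carrier
    S M N u v = diag (term M N (M ℕ.+ N)) u v

    A : ℕ → ℕ → ℕ → ℕ → Carrier
    A M N u v = G Q (M ℕ.+ v) u * G Q (N ℕ.+ u) v

    A-left0 : ∀ M N v → A M N 0 v ≈ G Q N v
    A-left0 M N v = trans (*-identityˡ _) (G-≡ v (ℕP.+-identityʳ N))

    A-right0 : ∀ M N u → A M N u 0 ≈ G Q M u
    A-right0 M N u = trans (*-identityʳ _) (G-≡ u (ℕP.+-identityʳ M))

    S-left0 : ∀ M N v → S M N 0 v ≈ G Q N v
    S-left0 M N v = solve 1 (λ g → con 1 :* con 1 :* g :* con 1 := g) refl (G Q N v)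

    S-right0 : ∀ M N u → S M N u 0 ≈ G Q M u
    S-right0 M N u = begin
      S M N u 0                           ≈⟨ diag-right0 (term M N (M ℕ.+ N)) u ⟩
      Q ^ (u ℕ.* 0) * G Q M u * 1# * 1#   ≈⟨ *-congʳ (*-congʳ (*-congʳ (^-≡ (ℕP.*-zeroʳ u)))) ⟩
      1# * G Q M u * 1# * 1#              ≈⟨ solve 1 (λ g → con 1 :* g :* con 1 :* con 1 := g) refl (G Q M u) ⟩
      G Q M u                             ∎

    A-recurrence₁ : ∀ M N u v → A (suc M) N (suc u) v ≈ A M (suc N) u v + Q ^ suc u * A M N (suc u) v
    A-recurrence₁ M N u v = trans (distribʳ _ _ _) (+-cong (*-congˡ (G-≡ v (ℕP.+-suc N u))) (*-assoc _ _ _))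

    A-recurrence₂ : ∀ M N u v → A M (suc N) u (suc v) ≈ A (suc M) N u v + Q ^ suc v * A M N u (suc v)
    A-recurrence₂ M N u v = trans (distribˡ _ _ _)
      (+-cong (*-congʳ (G-≡ u (ℕP.+-suc M v))) (solve 3 (λ x s y → x :* (s :* y) := s :* (x :* y)) refl _ _ _))

    S-recurrence₁ : ∀ M N u v → S (suc M) N (suc u) v ≈ S M (suc N) u v + Q ^ suc u * S M N (suc u) v
    S-recurrence₁ M N u zero =
      trans (S-right0 (suc M) N (suc u)) (sym (+-cong (S-right0 M (suc N) u) (*-congˡ (S-right0 M N (suc u)))))
    S-recurrence₁ M N u (suc v) = begin
      S (suc M) N (suc u) (suc v) ≈⟨ diag-split₁ (term (suc M) N (suc n)) fX fY pascal-M pascal-M0 u (suc v) ⟩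
      X + Y                       ≈⟨ +-congˡ (sym (trans (+-congˡ (sym W≈Z)) T₃+W≈Y)) ⟩
      X + (T₃ + Z)                ≈⟨ solve 3 (λ x t z → x :+ (t :+ z) := (z :+ x) :+ t) refl X T₃ Z ⟩
      (Z + X) + T₃                ≈⟨ +-congʳ (sym T₂≈Z+X) ⟩
      S M (suc N) u (suc v) + T₃  ∎
      where
      n = M ℕ.+ N
      γ : ℕ → Carrier
      γ k = G Q (suc n ℕ.+ k) k
      fX fY fZ fW : Family
      fX a b k = Q ^ (suc a ℕ.* b) * G Q M a * G Q N b * γ k
      fY a b k = Q ^ (a ℕ.* b) * Q ^ a * G Q M a * G Q N b * γ k
      fZ a b k = Q ^ (a ℕ.* suc b) * G Q M a * G Q N b * γ k
      fW a b zero = 0#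
      fW a b (suc k) = fY a b k
      X = diag fX u (suc v)
      Y = diag fY (suc u) (suc v)
      Z = diag fZ u v
      W = diag fW (suc u) (suc v)
      T₃ = Q ^ suc u * S M N (suc u) (suc v)
      pascal-M : ∀ a b k → term (suc M) N (suc n) (suc a) b k ≈ fX a b k + fY (suc a) b k
      pascal-M a b k = solve 6 (λ p x s y g c → p :* (x :+ s :* y) :* g :* c := p :* x :* g :* c :+ p :* s :* y :* g :* c) refl
                         (Q ^ (suc a ℕ.* b)) (G Q M a) (Q ^ suc a) (G Q M (suc a)) (G Q N b) (γ k)
      pascal-M0 : ∀ b k → term (suc M) N (suc n) 0 b k ≈ fY 0 b k
      pascal-M0 b k = solve 2 (λ x y → con 1 :* con 1 :* x :* y := con 1 :* con 1 :* con 1 :* x :* y) refl (G Q N b) (γ k)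
      pascal-N : ∀ a b k → term M (suc N) (suc n) a (suc b) k ≈ fZ a b k + fX a (suc b) k
      pascal-N a b k = trans
        (solve 6 (λ p x g s h c → p :* x :* (g :+ s :* h) :* c := p :* x :* g :* c :+ (s :* p) :* x :* h :* c) refl
               (Q ^ (a ℕ.* suc b)) (G Q M a) (G Q N b) (Q ^ suc b) (G Q N (suc b)) (γ k))
        (+-congˡ (*-congʳ (*-congʳ (*-congʳ (sym (^-+ Q (suc b) (a ℕ.* suc b)))))))
      pascal-k : ∀ a b k → Q ^ (a ℕ.+ k) * term M N n a b k + fW a b k ≈ fY a b k
      pascal-k a b zero = trans (+-identityʳ _) (trans (*-congʳ (^-≡ (ℕP.+-identityʳ a)))
        (solve 5 (λ pa p x y g → pa :* (p :* x :* y :* g) := p :* pa :* x :* y :* g) refl (Q ^ a) (Q ^ (a ℕ.* b)) (G Q M a) (G Q N b) 1#))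
      pascal-k a b (suc k) = begin
        Q ^ (a ℕ.+ suc k) * (pab * x * y * g) + pab * pa * x * y * γ k ≈⟨ +-congʳ (*-congʳ (^-+ Q a (suc k))) ⟩
        (pa * pk) * (pab * x * y * g) + pab * pa * x * y * γ k
          ≈⟨ solve 7 (λ pa pk pab x y g c → (pa :* pk) :* (pab :* x :* y :* g) :+ pab :* pa :* x :* y :* c
                                            := pab :* pa :* x :* y :* (c :+ pk :* g)) refl pa pk pab x y g (γ k) ⟩
        pab * pa * x * y * (γ k + pk * g) ≈⟨ *-congˡ (+-congʳ (sym (G-≡ k (ℕP.+-suc n k)))) ⟩
        fY a b (suc k) ∎
        where pa = Q ^ a
              pk = Q ^ suc k
              pab = Q ^ (a ℕ.* b)
              x = G Q M a
              y = G Q N b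
              g = G Q (n ℕ.+ suc k) (suc k)
      fW-shift : ∀ a b k → fW a b (suc k) ≈ fZ a b k
      fW-shift a b k = trans
        (solve 5 (λ pab pa x y c → pab :* pa :* x :* y :* c := pa :* pab :* x :* y :* c) refl (Q ^ (a ℕ.* b)) (Q ^ a) (G Q M a) (G Q N b) (γ k))
        (*-congʳ (*-congʳ (*-congʳ (trans (sym (^-+ Q a (a ℕ.* b))) (^-≡ (≡.sym (ℕP.*-suc a b)))))))
      T₂≈Z+X : S M (suc N) u (suc v) ≈ Z + X
      T₂≈Z+X = trans (diag-cong (λ a b k → *-congˡ (G-≡ k (≡.cong (ℕ._+ k) (ℕP.+-suc M N)))) u (suc v))
                     (diag-split₂ (term M (suc N) (suc n)) fZ fX pascal-N (λ _ _ → refl) u v)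
      T₃+W≈Y : T₃ + W ≈ Y
      T₃+W≈Y = begin
        T₃ + W                                               ≈⟨ +-congʳ (diag-scale Q (term M N n) (suc u) (suc v)) ⟩
        diag scaled (suc u) (suc v) + W                      ≈⟨ sym (diag-+ scaled fW (suc u) (suc v)) ⟩
        diag (λ a b k → scaled a b k + fW a b k) (suc u) (suc v) ≈⟨ diag-cong pascal-k (suc u) (suc v) ⟩
        Y                                                    ∎
        where scaled : Family
              scaled a b k = Q ^ (a ℕ.+ k) * term M N n a b k
      W≈Z : W ≈ Z
      W≈Z = trans (+-identityˡ _) (diag-cong fW-shift u v)

    -- the sum S is symmetric under (M, u) ↔ (N, v), which transports the first recurrence to the second
    S-sym : ∀ M N u v → S M N u v ≈ S N M v u
    S-sym M N u v = trans (diag-swap (term M N (M ℕ.+ N)) u v) (diag-cong swap v u)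
      where swap : ∀ a b k → term M N (M ℕ.+ N) b a k ≈ term N M (N ℕ.+ M) a b k
            swap a b k = trans
              (*-cong (trans (*-assoc _ _ _) (*-cong (^-≡ (ℕP.*-comm b a)) (*-comm _ _))) (G-≡ k (≡.cong (ℕ._+ k) (ℕP.+-comm M N))))
              (*-congʳ (sym (*-assoc _ _ _)))

    S-recurrence₂ : ∀ M N u v → S M (suc N) u (suc v) ≈ S (suc M) N u v + Q ^ suc v * S M N u (suc v)
    S-recurrence₂ M N u v = trans (S-sym M (suc N) u (suc v)) (trans (S-recurrence₁ N M v u)
      (+-cong (sym (S-sym (suc M) N u v)) (*-congˡ (sym (S-sym M N u (suc v))))))

    S-00 : ∀ u v → S 0 0 u v ≈ δ₂ u v
    S-00 = diag-δ₂ (term 0 0 0) (λ a b k → *-vanishˡ (*-vanishˡ (*-vanishʳ refl))) (λ a b k → *-vanishˡ (*-vanishʳ refl))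
             (λ k → trans (*-congʳ (trans (*-identityʳ _) (*-identityˡ _))) (trans (*-identityˡ _) (G-diag Q k)))

    product-formula-bounded : ∀ t M N u v → M ℕ.+ N ℕ.+ u ℕ.+ v ℕ.≤ t → A M N u v ≈ S M N u v
    product-formula-bounded t M N zero v _ = trans (A-left0 M N v) (sym (S-left0 M N v))
    product-formula-bounded t M N (suc u) zero _ = trans (A-right0 M N (suc u)) (sym (S-right0 M N (suc u)))
    product-formula-bounded t zero zero (suc u) (suc v) _ = trans (G-transposed-product Q (suc u) (suc v)) (sym (S-00 (suc u) (suc v)))
    product-formula-bounded (suc t) (suc M) N (suc u) v (ℕ.s≤s bound) = begin
      A (suc M) N (suc u) v                                 ≈⟨ A-recurrence₁ M N u v ⟩
      A M (suc N) u v + Q ^ suc u * A M N (suc u) v         ≈⟨ +-cong (product-formula-bounded t M (suc N) u v bound′)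
                                                                      (*-congˡ (product-formula-bounded t M N (suc u) v bound)) ⟩
      S M (suc N) u v + Q ^ suc u * S M N (suc u) v         ≈⟨ sym (S-recurrence₁ M N u v) ⟩
      S (suc M) N (suc u) v                                 ∎
      where bound′ = ℕP.≤-trans (ℕP.≤-reflexive (move M N u v)) bound
              where move : ∀ M N u v → M ℕ.+ suc N ℕ.+ u ℕ.+ v ≡ M ℕ.+ N ℕ.+ suc u ℕ.+ v
                    move = solve-∀
    product-formula-bounded (suc t) zero (suc N) (suc u) (suc v) (ℕ.s≤s bound) = begin
      A 0 (suc N) (suc u) (suc v)                           ≈⟨ A-recurrence₂ 0 N (suc u) v ⟩
      A 1 N (suc u) v + Q ^ suc v * A 0 N (suc u) (suc v)   ≈⟨ +-cong (product-formula-bounded t 1 N (suc u) v bound′)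
                                                                      (*-congˡ (product-formula-bounded t 0 N (suc u) (suc v) bound)) ⟩
      S 1 N (suc u) v + Q ^ suc v * S 0 N (suc u) (suc v)   ≈⟨ sym (S-recurrence₂ 0 N (suc u) v) ⟩
      S 0 (suc N) (suc u) (suc v)                           ∎
      where bound′ = ℕP.≤-trans (ℕP.≤-reflexive (move N u v)) bound
              where move : ∀ N u v → 1 ℕ.+ N ℕ.+ suc u ℕ.+ v ≡ N ℕ.+ suc u ℕ.+ suc v
                    move = solve-∀

    product-formula : ∀ M N u v → A M N u v ≈ S M N u v
    product-formula M N u v = product-formula-bounded _ M N u v ℕP.≤-refl
  open ProductFormula using (product-formula)

  -- Formal power series in an auxiliary variable z, represented by their
  -- coefficient sequences; conv is the Cauchy product.
  module PowerSeries where
    Series : Set c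
    Series = ℕ → Carrier

    infix 4 _≋_
    _≋_ : Series → Series → Set ℓ
    f ≋ g = ∀ m → f m ≈ g m

    ≋-trans : ∀ {f g h} → f ≋ g → g ≋ h → f ≋ h
    ≋-trans f≋g g≋h m = trans (f≋g m) (g≋h m)

    ≋-sym : ∀ {f g} → f ≋ g → g ≋ f
    ≋-sym f≋g m = sym (f≋g m)

    -- antidiagonal t g = Σ_{u+v=t} g u v
    antidiagonal : (ℕ → ℕ → Carrier) → ℕ → Carrier
    antidiagonal g zero = g 0 0
    antidiagonal g (suc t) = g 0 (suc t) + antidiagonal (λ u v → g (suc u) v) t

    antidiagonal-cong : ∀ {g h} → (∀ u v → g u v ≈ h u v) → ∀ t → antidiagonal g t ≈ antidiagonal h t
    antidiagonal-cong g≈h zero = g≈h 0 0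
    antidiagonal-cong g≈h (suc t) = +-cong (g≈h _ _) (antidiagonal-cong (λ u v → g≈h (suc u) v) t)

    antidiagonal-+ : ∀ g h t → antidiagonal (λ u v → g u v + h u v) t ≈ antidiagonal g t + antidiagonal h t
    antidiagonal-+ g h zero = refl
    antidiagonal-+ g h (suc t) = trans (+-congˡ (antidiagonal-+ _ _ t)) (interchange _ _ _ _)

    antidiagonal-*ˡ : ∀ x g t → x * antidiagonal g t ≈ antidiagonal (λ u v → x * g u v) t
    antidiagonal-*ˡ x g zero = refl
    antidiagonal-*ˡ x g (suc t) = trans (distribˡ _ _ _) (+-congˡ (antidiagonal-*ˡ x _ t))

    antidiagonal-vanish : ∀ g → (∀ u v → g u v ≈ 0#) → ∀ t → antidiagonal g t ≈ 0#
    antidiagonal-vanish g g≈0 zero = g≈0 0 0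
    antidiagonal-vanish g g≈0 (suc t) = +-vanish (g≈0 _ _) (antidiagonal-vanish _ (λ u v → g≈0 (suc u) v) t)

    antidiagonal-last : ∀ g t → antidiagonal g (suc t) ≈ antidiagonal (λ u v → g u (suc v)) t + g (suc t) 0
    antidiagonal-last g zero = refl
    antidiagonal-last g (suc t) = trans (+-congˡ (antidiagonal-last (λ u v → g (suc u) v) t)) (sym (+-assoc _ _ _))

    conv : Series → Series → Series
    conv f g = antidiagonal (λ u v → f u * g v)

    conv-cong : ∀ {f f′ g g′} → f ≋ f′ → g ≋ g′ → conv f g ≋ conv f′ g′
    conv-cong f≋f′ g≋g′ = antidiagonal-cong (λ u v → *-cong (f≋f′ u) (g≋g′ v))

    conv-congʳ : ∀ f {g g′} → g ≋ g′ → conv f g ≋ conv f g′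
    conv-congʳ f = conv-cong (λ _ → refl)

    conv-+ʳ : ∀ f g h → conv f (λ m → g m + h m) ≋ (λ t → conv f g t + conv f h t)
    conv-+ʳ f g h t = trans (antidiagonal-cong (λ u v → distribˡ _ _ _) t) (antidiagonal-+ _ _ t)

    conv-*ʳ : ∀ f x g → conv f (λ m → x * g m) ≋ (λ t → x * conv f g t)
    conv-*ʳ f x g t = trans (antidiagonal-cong (λ u v → solve 3 (λ a x b → a :* (x :* b) := x :* (a :* b)) refl _ _ _) t)
                            (sym (antidiagonal-*ˡ x _ t))

    one : Series
    one zero = 1#
    one (suc _) = 0#

    conv-oneˡ : ∀ g → conv one g ≋ g
    conv-oneˡ g zero = *-identityˡ _
    conv-oneˡ g (suc t) = trans (+-cong (*-identityˡ _) (antidiagonal-vanish _ (λ u v → zeroˡ _) t)) (+-identityʳ _)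

    conv-oneʳ : ∀ f → conv f one ≋ f
    conv-oneʳ f zero = *-identityʳ _
    conv-oneʳ f (suc t) = trans (+-cong (zeroʳ _) (conv-oneʳ (λ u → f (suc u)) t)) (+-identityˡ _)

    -- multiplication by z
    shift : Series → Series
    shift f zero = 0#
    shift f (suc n) = f n

    conv-shiftʳ : ∀ f g → conv f (shift g) ≋ shift (conv f g)
    conv-shiftʳ f g zero = zeroʳ _
    conv-shiftʳ f g (suc zero) = trans (+-congˡ (zeroʳ _)) (+-identityʳ _)
    conv-shiftʳ f g (suc (suc t)) = +-congˡ (conv-shiftʳ (λ u → f (suc u)) g (suc t))

    conv-shift²ʳ : ∀ f g → conv f (shift (shift g)) ≋ shift (shift (conv f g))
    conv-shift²ʳ f g zero = conv-shiftʳ f (shift g) zero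
    conv-shift²ʳ f g (suc t) = trans (conv-shiftʳ f (shift g) (suc t)) (conv-shiftʳ f g t)

    -- multiplication by the linear factor 1 + x z
    factor : Carrier → Series → Series
    factor x f zero = f 0
    factor x f (suc m) = f (suc m) + x * f m

    factor-cong : ∀ {x y f g} → x ≈ y → f ≋ g → factor x f ≋ factor y g
    factor-cong x≈y f≋g zero = f≋g 0
    factor-cong x≈y f≋g (suc m) = +-cong (f≋g _) (*-cong x≈y (f≋g m))

    factor-comm : ∀ x y f → factor x (factor y f) ≋ factor y (factor x f)
    factor-comm x y f zero = refl
    factor-comm x y f (suc zero) = solve 4 (λ a b x y → (b :+ y :* a) :+ x :* a := (b :+ x :* a) :+ y :* a) refl _ _ _ _
    factor-comm x y f (suc (suc m)) =
      solve 5 (λ c b a x y → (c :+ y :* b) :+ x :* (b :+ y :* a) := (c :+ x :* b) :+ y :* (b :+ x :* a)) refl _ _ _ _ _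

    conv-factor : ∀ x f g → conv (factor x f) g ≋ factor x (conv f g)
    conv-factor x f g zero = refl
    conv-factor x f g (suc t) = begin
      f 0 * g (suc t) + antidiagonal (λ u v → (f (suc u) + x * f u) * g v) t
        ≈⟨ +-congˡ (antidiagonal-cong (λ u v → trans (distribʳ _ _ _) (+-congˡ (*-assoc _ _ _))) t) ⟩
      f 0 * g (suc t) + antidiagonal (λ u v → f (suc u) * g v + x * (f u * g v)) t
        ≈⟨ +-congˡ (trans (antidiagonal-+ _ _ t) (+-congˡ (sym (antidiagonal-*ˡ x _ t)))) ⟩
      f 0 * g (suc t) + (antidiagonal (λ u v → f (suc u) * g v) t + x * conv f g t) ≈⟨ sym (+-assoc _ _ _) ⟩
      factor x (conv f g) (suc t) ∎

    -- qprod x Q n g = (1 + xz)(1 + xQz)⋯(1 + xQ^(n-1)z) · g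
    qprod : Carrier → Carrier → ℕ → Series → Series
    qprod x Q zero g = g
    qprod x Q (suc n) g = factor (x * Q ^ n) (qprod x Q n g)

    qprod-cong : ∀ x Q n {g h} → g ≋ h → qprod x Q n g ≋ qprod x Q n h
    qprod-cong x Q zero g≋h = g≋h
    qprod-cong x Q (suc n) g≋h = factor-cong refl (qprod-cong x Q n g≋h)

    qprod-≡ : ∀ x Q {n n′} g → n ≡ n′ → qprod x Q n g ≋ qprod x Q n′ g
    qprod-≡ x Q g ≡.refl m = refl

    qprod-conv : ∀ x Q n g → qprod x Q n g ≋ conv (qprod x Q n one) g
    qprod-conv x Q zero g m = sym (conv-oneˡ g m)
    qprod-conv x Q (suc n) g m = trans (factor-cong refl (qprod-conv x Q n g) m) (sym (conv-factor _ _ g m))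

    qprod-factor : ∀ x Q n y g → qprod x Q n (factor y g) ≋ factor y (qprod x Q n g)
    qprod-factor x Q zero y g m = refl
    qprod-factor x Q (suc n) y g m = trans (factor-cong refl (qprod-factor x Q n y g) m) (factor-comm _ y _ m)

    -- q-binomial theorem:  ∏_{i<n} (1 + x Q^i z) = Σ_m X m [n; m]_Q z^m
    -- for any X with X 0 = 1 and X (m+1) = x Q^m X m  (so X m = x^m Q^(m(m-1)/2))
    q-binomial : ∀ x Q (X : Series) → X 0 ≈ 1# → (∀ k → X (suc k) ≈ x * Q ^ k * X k) →
                 ∀ n → qprod x Q n one ≋ (λ m → X m * G Q n m)
    q-binomial x Q X X0 Xs zero zero = sym (trans (*-identityʳ _) X0)
    q-binomial x Q X X0 Xs zero (suc m) = sym (zeroʳ _)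
    q-binomial x Q X X0 Xs (suc n) zero = q-binomial x Q X X0 Xs n 0
    q-binomial x Q X X0 Xs (suc n) (suc k) = begin
      qprod x Q n one (suc k) + (x * Q ^ n) * qprod x Q n one k
        ≈⟨ +-cong (trans (q-binomial x Q X X0 Xs n (suc k)) (*-congʳ (Xs k))) (*-congˡ (q-binomial x Q X X0 Xs n k)) ⟩
      (x * Q ^ k * X k) * G Q n (suc k) + (x * Q ^ n) * (X k * G Q n k)
        ≈⟨ solve 6 (λ x a b y g h → (x :* a :* y) :* g :+ (x :* b) :* (y :* h) := (x :* y) :* (a :* g :+ b :* h))
                   refl x (Q ^ k) (Q ^ n) (X k) (G Q n (suc k)) (G Q n k) ⟩
      (x * X k) * (Q ^ k * G Q n (suc k) + Q ^ n * G Q n k) ≈⟨ *-congˡ (sym (pascal₂ Q n k)) ⟩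
      (x * X k) * (Q ^ k * G Q (suc n) (suc k))
        ≈⟨ solve 4 (λ x y a g → (x :* y) :* (a :* g) := (x :* a :* y) :* g) refl x (X k) (Q ^ k) _ ⟩
      (x * Q ^ k * X k) * G Q (suc n) (suc k) ≈⟨ *-congʳ (sym (Xs k)) ⟩
      X (suc k) * G Q (suc n) (suc k) ∎

    -- spread h = Σ_k h k z^(2k), the substitution z ↦ z²
    spread : Series → Series
    spread h zero = h 0
    spread h (suc zero) = 0#
    spread h (suc (suc n)) = spread (λ k → h (suc k)) n

    spread-cong : ∀ {h h′} → h ≋ h′ → spread h ≋ spread h′
    spread-cong h≋h′ zero = h≋h′ 0
    spread-cong h≋h′ (suc zero) = refl
    spread-cong h≋h′ (suc (suc k)) = spread-cong (λ i → h≋h′ (suc i)) k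

    spread-parity : ∀ h k → spread h k ≈ (if evenℕ k then h ℕ.⌊ k /2⌋ else 0#)
    spread-parity h zero = refl
    spread-parity h (suc zero) = refl
    spread-parity h (suc (suc k)) = spread-parity (λ i → h (suc i)) k

    spread-unfold : ∀ h → spread h ≋ (λ m → h 0 * one m + shift (shift (spread (λ k → h (suc k)))) m)
    spread-unfold h zero = sym (trans (+-identityʳ _) (*-identityʳ _))
    spread-unfold h (suc zero) = sym (trans (+-identityʳ _) (zeroʳ _))
    spread-unfold h (suc (suc n)) = sym (trans (+-congʳ (zeroʳ _)) (+-identityˡ _))

    conv-spread : ∀ f h → conv f (spread h) ≋ (λ t → h 0 * f t + shift (shift (conv f (spread (λ k → h (suc k))))) t)
    conv-spread f h t = begin
      conv f (spread h) t                                        ≈⟨ conv-congʳ f (spread-unfold h) t ⟩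
      conv f (λ m → h 0 * one m + shift (shift h′) m) t          ≈⟨ conv-+ʳ f _ _ t ⟩
      conv f (λ m → h 0 * one m) t + conv f (shift (shift h′)) t
        ≈⟨ +-cong (trans (conv-*ʳ f (h 0) one t) (*-congˡ (conv-oneʳ f t))) (conv-shift²ʳ f h′ t) ⟩
      h 0 * f t + shift (shift (conv f h′)) t                    ∎
      where h′ = spread (λ k → h (suc k))

    -- the family f a · g b · h k summed over a + b + 2k = t, read in two ways:
    -- as an antidiagonal of diagonal sums and as the coefficient of f · g · h(z²)
    antidiagonal-of-diag : ∀ f g h t →
      antidiagonal (λ u v → diag (λ a b k → f a * g b * h k) u v) t ≈ conv f (conv g (spread h)) t
    antidiagonal-of-diag f g h t = trans (split-k0 t) (trans (+-cong first-layer (shift-tail t)) (sym (conv-split t)))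
      where
      h′ = λ k → h (suc k)
      φ : Family
      φ a b k = f a * g b * h k
      Y = conv f (conv g (spread h′))
      first-layer : antidiagonal (λ u v → φ u v 0) t ≈ h 0 * conv f g t
      first-layer = trans (antidiagonal-cong (λ u v → *-comm _ _) t) (sym (antidiagonal-*ˡ (h 0) _ t))
      shift-tail : ∀ t → shift (shift (antidiagonal (λ u v → diag (shiftK φ) u v))) t ≈ shift (shift Y) t
      shift-tail zero = refl
      shift-tail (suc zero) = refl
      shift-tail (suc (suc t)) = antidiagonal-of-diag f g h′ t
      split-k0 : ∀ t → antidiagonal (λ u v → diag φ u v) t
                       ≈ antidiagonal (λ u v → φ u v 0) t + shift (shift (antidiagonal (λ u v → diag (shiftK φ) u v))) t
      split-k0 zero = sym (+-identityʳ _)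
      split-k0 (suc zero) = sym (+-identityʳ _)
      split-k0 (suc (suc t)) = begin
        p₀ + antidiagonal (λ u v → diag φ (suc u) v) (suc t)
          ≈⟨ +-congˡ (antidiagonal-last (λ u v → diag φ (suc u) v) t) ⟩
        p₀ + (antidiagonal (λ u v → φ (suc u) (suc v) 0 + diag (shiftK φ) u v) t + pₗ)
          ≈⟨ +-congˡ (+-congʳ (antidiagonal-+ _ _ t)) ⟩
        p₀ + ((antidiagonal (λ u v → φ (suc u) (suc v) 0) t + antidiagonal (λ u v → diag (shiftK φ) u v) t) + pₗ)
          ≈⟨ solve 4 (λ a b c d → a :+ ((b :+ c) :+ d) := (a :+ (b :+ d)) :+ c) refl _ _ _ _ ⟩
        (p₀ + (antidiagonal (λ u v → φ (suc u) (suc v) 0) t + pₗ)) + antidiagonal (λ u v → diag (shiftK φ) u v) t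
          ≈⟨ +-congʳ (+-congˡ (sym (antidiagonal-last (λ u v → φ (suc u) v 0) t))) ⟩
        antidiagonal (λ u v → φ u v 0) (suc (suc t)) + antidiagonal (λ u v → diag (shiftK φ) u v) t ∎
        where p₀ = φ 0 (suc (suc t)) 0
              pₗ = φ (suc (suc t)) 0 0
      conv-split : ∀ t → conv f (conv g (spread h)) t ≈ h 0 * conv f g t + shift (shift Y) t
      conv-split t = begin
        conv f (conv g (spread h)) t                                      ≈⟨ conv-congʳ f (conv-spread g h) t ⟩
        conv f (λ m → h 0 * g m + shift (shift (conv g (spread h′))) m) t ≈⟨ conv-+ʳ f _ _ t ⟩
        conv f (λ m → h 0 * g m) t + conv f (shift (shift (conv g (spread h′)))) t
          ≈⟨ +-cong (conv-*ʳ f (h 0) g t) (conv-shift²ʳ f _ t) ⟩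
        h 0 * conv f g t + shift (shift Y) t                              ∎
  open PowerSeries

  module FiniteSums where
    Σ₀ : ℕ → (ℕ → Carrier) → Carrier
    Σ₀ = sumTo R

    Σ± : ℕ → (ℤ → Carrier) → Carrier
    Σ± = sumSym R

    Σ₀-cong : ∀ n {f g} → (∀ i → i ℕ.≤ n → f i ≈ g i) → Σ₀ n f ≈ Σ₀ n g
    Σ₀-cong zero f≈g = f≈g 0 ℕ.z≤n
    Σ₀-cong (suc n) f≈g = +-cong (Σ₀-cong n (λ i i≤n → f≈g i (ℕP.m≤n⇒m≤1+n i≤n))) (f≈g (suc n) ℕP.≤-refl)

    Σ₀-≡ : ∀ {n m} f → n ≡ m → Σ₀ n f ≈ Σ₀ m f
    Σ₀-≡ f ≡.refl = refl

    Σ₀-first : ∀ n f → Σ₀ (suc n) f ≈ f 0 + Σ₀ n (λ i → f (suc i))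
    Σ₀-first zero f = refl
    Σ₀-first (suc n) f = trans (+-congʳ (Σ₀-first n f)) (+-assoc _ _ _)

    Σ₀-+ : ∀ n f g → Σ₀ n (λ i → f i + g i) ≈ Σ₀ n f + Σ₀ n g
    Σ₀-+ zero f g = refl
    Σ₀-+ (suc n) f g = trans (+-congʳ (Σ₀-+ n f g)) (interchange _ _ _ _)

    Σ₀-*ˡ : ∀ n x f → x * Σ₀ n f ≈ Σ₀ n (λ i → x * f i)
    Σ₀-*ˡ zero x f = refl
    Σ₀-*ˡ (suc n) x f = trans (distribˡ _ _ _) (+-congʳ (Σ₀-*ˡ n x f))

    Σ₀-extend : ∀ a f → (∀ i → a ℕ.< i → f i ≈ 0#) → ∀ d → Σ₀ (a ℕ.+ d) f ≈ Σ₀ a f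
    Σ₀-extend a f f≈0 zero = Σ₀-≡ f (ℕP.+-identityʳ a)
    Σ₀-extend a f f≈0 (suc d) = trans (Σ₀-≡ f (ℕP.+-suc a d))
      (trans (+-cong (Σ₀-extend a f f≈0 d) (f≈0 _ (ℕ.s≤s (ℕP.m≤m+n a d)))) (+-identityʳ _))

    antidiagonal-Σ₀ : ∀ g t → antidiagonal g t ≈ Σ₀ t (λ u → g u (t ℕ.∸ u))
    antidiagonal-Σ₀ g zero = refl
    antidiagonal-Σ₀ g (suc t) = trans (+-congˡ (antidiagonal-Σ₀ (λ u v → g (suc u) v) t)) (sym (Σ₀-first t _))

    Σ±-cong : ∀ K {f g} → (∀ j → f j ≈ g j) → Σ± K f ≈ Σ± K g
    Σ±-cong zero f≈g = f≈g _
    Σ±-cong (suc K) f≈g = +-cong (+-cong (Σ±-cong K f≈g) (f≈g _)) (f≈g _)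

    Σ±-≡ : ∀ {n m} f → n ≡ m → Σ± n f ≈ Σ± m f
    Σ±-≡ f ≡.refl = refl

    Σ±-*ˡ : ∀ K x f → x * Σ± K f ≈ Σ± K (λ j → x * f j)
    Σ±-*ˡ zero x f = refl
    Σ±-*ˡ (suc K) x f = trans (distribˡ _ _ _) (+-congʳ (trans (distribˡ _ _ _) (+-congʳ (Σ±-*ˡ K x f))))

    Σ±-vanish : ∀ K f → (∀ j → f j ≈ 0#) → Σ± K f ≈ 0#
    Σ±-vanish zero f f≈0 = f≈0 _
    Σ±-vanish (suc K) f f≈0 = +-vanish (+-vanish (Σ±-vanish K f f≈0) (f≈0 _)) (f≈0 _)

    Σ±-Σ₀-swap : ∀ K n (F : ℤ → ℕ → Carrier) → Σ± K (λ j → Σ₀ n (F j)) ≈ Σ₀ n (λ i → Σ± K (λ j → F j i))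
    Σ±-Σ₀-swap zero n F = refl
    Σ±-Σ₀-swap (suc K) n F = trans (+-congʳ (+-congʳ (Σ±-Σ₀-swap K n F))) (trans (+-congʳ (sym (Σ₀-+ n _ _))) (sym (Σ₀-+ n _ _)))

    Σ±-extend : ∀ k C → (∀ d → C (+ suc (k ℕ.+ d)) ≈ 0#) → (∀ d → C -[1+ k ℕ.+ d ] ≈ 0#) →
                ∀ d → Σ± (k ℕ.+ d) C ≈ Σ± k C
    Σ±-extend k C C₊≈0 C₋≈0 zero = Σ±-≡ C (ℕP.+-identityʳ k)
    Σ±-extend k C C₊≈0 C₋≈0 (suc d) = trans (Σ±-≡ C (ℕP.+-suc k d))
      (trans (+-cong (+-cong (Σ±-extend k C C₊≈0 C₋≈0 d) (C₊≈0 d)) (C₋≈0 d)) (trans (+-identityʳ _) (+-identityʳ _)))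

    -- if C vanishes at ±m whenever k + m is odd, then Σ_{|j| ≤ k} C j
    -- runs over j = v - u with u + v = k, i.e. u = 0, …, k
    Σ±-parity : ∀ k C → (∀ m → evenℕ (k ℕ.+ m) ≡ false → (C (+ m) ≈ 0#) × (C (ℤ.- (+ m)) ≈ 0#)) →
                Σ± k C ≈ Σ₀ k (λ u → C (+ (k ℕ.∸ u) ℤ.- + u))
    Σ±-parity zero C odd≈0 = refl
    Σ±-parity (suc zero) C odd≈0 = +-congʳ (trans (+-congʳ (proj₁ (odd≈0 0 ≡.refl))) (+-identityˡ _))
    Σ±-parity (suc (suc k)) C odd≈0 = begin
      Σ± k C + C (+ suc k) + C -[1+ k ] + C (+ suc (suc k)) + C -[1+ suc k ]
        ≈⟨ +-congʳ (+-congʳ (trans (+-congʳ (+-congˡ (proj₁ odd))) (+-congˡ (proj₂ odd)))) ⟩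
      Σ± k C + 0# + 0# + C (+ suc (suc k)) + C -[1+ suc k ]
        ≈⟨ +-congʳ (+-congʳ (trans (+-identityʳ _) (+-identityʳ _))) ⟩
      Σ± k C + C (+ suc (suc k)) + C -[1+ suc k ]
        ≈⟨ +-congʳ (+-cong (Σ±-parity k C odd≈0) (reflexive (≡.cong C (≡.sym (ℤP.+-identityʳ (+ suc (suc k))))))) ⟩
      Σ₀ k (λ u → C (+ (k ℕ.∸ u) ℤ.- + u)) + f 0 + C -[1+ suc k ]
        ≈⟨ +-cong (+-comm _ _) (reflexive (≡.cong (λ z → C (+ z ℤ.- + suc (suc k))) (≡.sym (ℕP.n∸n≡0 k)))) ⟩
      f 0 + Σ₀ k (λ u → C (+ (k ℕ.∸ u) ℤ.- + u)) + f (suc (suc k))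
        ≈⟨ +-congʳ (+-congˡ (Σ₀-cong k (λ u u≤k → reflexive (≡.cong C (inner u u≤k))))) ⟩
      f 0 + Σ₀ k (λ u → f (suc u)) + f (suc (suc k)) ≈⟨ +-congʳ (sym (Σ₀-first k f)) ⟩
      Σ₀ (suc (suc k)) f ∎
      where
      open Arithmetic using (even-odd; +-suc-suc)
      odd = odd≈0 (suc k) (even-odd k)
      f : ℕ → Carrier
      f u = C (+ (suc (suc k) ℕ.∸ u) ℤ.- + u)
      inner : ∀ u → u ℕ.≤ k → + (k ℕ.∸ u) ℤ.- + u ≡ + (suc (suc k) ℕ.∸ suc u) ℤ.- + suc u
      inner u u≤k = ≡.trans (≡.sym (+-suc-suc (k ℕ.∸ u) u)) (≡.cong (λ z → + z ℤ.- + suc u) (≡.sym (ℕP.+-∸-assoc 1 u≤k)))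
  open FiniteSums

  module GuardedProducts where
    open Arithmetic using (half-negative)

    qbin-negative : ∀ Q a e → qbin R Q a -[1+ e ] ≈ 0#
    qbin-negative Q (+ m) e = refl
    qbin-negative Q -[1+ m ] e = refl

    qbin-cong : ∀ {x y} a b → x ≈ y → qbin R x a b ≈ qbin R y a b
    qbin-cong (+ m) (+ n) x≈y = G-cong (m ℕ.+ n) m x≈y
    qbin-cong (+ m) -[1+ n ] x≈y = refl
    qbin-cong -[1+ m ] b x≈y = refl

    -- [a; u] in the paper's convention  [ m+n ; m ]  with m = u, n = a - u
    qbin-difference : ∀ Q a u → qbin R Q (+ a ℤ.- + u) (+ u) ≈ G Q a u
    qbin-difference Q a u with ℕP.≤-<-connex u a
    ... | inj₁ u≤a rewrite Arithmetic.+-∸ a u u≤a = trans (G-sym Q (a ℕ.∸ u) u) (G-≡ u (ℕP.m∸n+n≡m u≤a))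
    ... | inj₂ a<u rewrite ℤP.m-n≡m⊖n a u | ≡.sym (ℕP.m+[n∸m]≡n a<u) | Arithmetic.⊖-below a (u ℕ.∸ suc a) =
          sym (G-vanish Q a (suc a ℕ.+ (u ℕ.∸ suc a)) (ℕP.m≤m+n (suc a) _))

    if-false : ∀ (b : Bool) {X : Carrier} → b ≡ false → (if b then X else 0#) ≈ 0#
    if-false false ≡.refl = refl

    if-cong : ∀ (b : Bool) {X Y} → X ≈ Y → (if b then X else 0#) ≈ (if b then Y else 0#)
    if-cong true X≈Y = X≈Y
    if-cong false X≈Y = refl

    if-*ˡ : ∀ (b : Bool) X Y → (if b then X * Y else 0#) ≈ X * (if b then Y else 0#)
    if-*ˡ true X Y = refl
    if-*ˡ false X Y = sym (zeroʳ X)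

    if-vanish : ∀ (b : Bool) {X} → (b ≡ true → X ≈ 0#) → (if b then X else 0#) ≈ 0#
    if-vanish true X≈0 = X≈0 ≡.refl
    if-vanish false X≈0 = refl

    qbin-half-negative : ∀ Q y x → evenℕ (suc x) ≡ true → qbin R Q y (halfℤ -[1+ x ]) ≈ 0#
    qbin-half-negative Q y x even with half-negative x even
    ... | e , half≡ = trans (reflexive (≡.cong (qbin R Q y) half≡)) (qbin-negative Q y e)

    guarded-vanish₁ : ∀ Q z x Y₁ Y₂ → z ≡ -[1+ x ] →
                      (if evenℤ z then qbin R Q Y₁ (halfℤ z) * Y₂ else 0#) ≈ 0#
    guarded-vanish₁ Q z x Y₁ Y₂ ≡.refl = if-vanish (evenℤ z) (λ even → *-vanishˡ (qbin-half-negative Q Y₁ x even))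

    guarded-vanish₂ : ∀ Q z z₂ x Y₁ Y₂ → z₂ ≡ -[1+ x ] → evenℤ z ≡ evenℕ (suc x) →
                      (if evenℤ z then Y₁ * qbin R Q Y₂ (halfℤ z₂) else 0#) ≈ 0#
    guarded-vanish₂ Q z z₂ x Y₁ Y₂ ≡.refl parity =
      if-vanish (evenℤ z) (λ even → *-vanishʳ (qbin-half-negative Q Y₂ x (≡.trans (≡.sym parity) even)))
  open GuardedProducts

  module Identity (q : Carrier) (M : ℕ) where
    open Arithmetic using (tri; tri3; weight; weight-split; weight-abs)
    open ProductFormula (q ^ 6) using (A; term)

    Q₆ : Carrier
    Q₆ = q ^ 6

    ρ : Series
    ρ k = G Q₆ (2 ℕ.* M ℕ.+ k) (2 ℕ.* M)

    P : ℕ → Series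
    P r = qprod (q ^ r) Q₆ M one

    P-coefficients : ∀ r → P r ≋ (λ m → q ^ tri r m * G Q₆ M m)
    P-coefficients r = q-binomial (q ^ r) Q₆ (λ m → q ^ tri r m) refl step M
      where step : ∀ k → q ^ tri r (suc k) ≈ q ^ r * Q₆ ^ k * q ^ tri r k
            step k = trans (^-+ q (r ℕ.+ 6 ℕ.* k) (tri r k)) (*-congʳ (sym (^-affine q r 6 k)))

    product : Series
    product = conv (P 3) (conv (P 1) (conv (P 5) (spread ρ)))

    -- Left-hand side: q^(m²) [3M; m]_{q²} are the coefficients of ∏_{i<3M} (1 + z q^(2i+1)),
    -- whose factors regroup by i mod 3 into P 1 · P 3 · P 5.
    E : Series
    E m = q ^ (m ℕ.* m) * G (q ^ 2) (3 ℕ.* M) m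

    E-coefficients : qprod (q ^ 1) (q ^ 2) (3 ℕ.* M) one ≋ E
    E-coefficients = q-binomial (q ^ 1) (q ^ 2) (λ m → q ^ (m ℕ.* m)) refl step (3 ℕ.* M)
      where square : ∀ k → suc k ℕ.* suc k ≡ 1 ℕ.+ 2 ℕ.* k ℕ.+ k ℕ.* k
            square = solve-∀
            step : ∀ k → q ^ (suc k ℕ.* suc k) ≈ q ^ 1 * (q ^ 2) ^ k * q ^ (k ℕ.* k)
            step k = trans (^-≡ (square k)) (trans (^-+ q (1 ℕ.+ 2 ℕ.* k) (k ℕ.* k)) (*-congʳ (sym (^-affine q 1 2 k))))

    -- ∏_{i<3M} (1 + z q^(2i+1)) = P 3 · P 1 · P 5 as operators on series: the three
    -- factors i = 3M, 3M+1, 3M+2 are q^(6M+1), q^(6M+3), q^(6M+5), one for each P r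
    regroup : ∀ M H → qprod (q ^ 1) (q ^ 2) (3 ℕ.* M) H ≋ qprod (q ^ 3) Q₆ M (qprod (q ^ 1) Q₆ M (qprod (q ^ 5) Q₆ M H))
    regroup zero H m = refl
    regroup (suc M) H m = begin
      qprod (q ^ 1) (q ^ 2) (3 ℕ.* suc M) H m
        ≈⟨ qprod-≡ (q ^ 1) (q ^ 2) H (three-suc M) m ⟩
      factor (b 2) (factor (b 1) (factor (b 0) (qprod (q ^ 1) (q ^ 2) (3 ℕ.* M) H))) m
        ≈⟨ factor-cong (exponent 5 2 (six₅ M)) (factor-cong (exponent 3 1 (six₃ M)) (factor-cong (exponent 1 0 (six₁ M)) (regroup M H))) m ⟩
      factor a₅ (factor a₃ (factor a₁ (P₃ (P₁ (P₅ H))))) m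
        ≈⟨ factor-comm a₅ a₃ _ m ⟩
      factor a₃ (factor a₅ (factor a₁ (P₃ (P₁ (P₅ H))))) m
        ≈⟨ factor-cong refl (factor-comm a₅ a₁ _) m ⟩
      factor a₃ (factor a₁ (factor a₅ (P₃ (P₁ (P₅ H))))) m
        ≈⟨ factor-cong refl (factor-cong refl (≋-sym (≋-trans (qprod-cong (q ^ 3) Q₆ M (qprod-factor (q ^ 1) Q₆ M a₅ _))
                                                               (qprod-factor (q ^ 3) Q₆ M a₅ _)))) m ⟩
      factor a₃ (factor a₁ (P₃ (P₁ (factor a₅ (P₅ H))))) m
        ≈⟨ factor-cong refl (≋-sym (qprod-factor (q ^ 3) Q₆ M a₁ _)) m ⟩
      factor a₃ (P₃ (factor a₁ (P₁ (factor a₅ (P₅ H))))) m ∎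
      where
      P₁ P₃ P₅ : Series → Series
      P₁ = qprod (q ^ 1) Q₆ M
      P₃ = qprod (q ^ 3) Q₆ M
      P₅ = qprod (q ^ 5) Q₆ M
      a₁ = q ^ 1 * Q₆ ^ M
      a₃ = q ^ 3 * Q₆ ^ M
      a₅ = q ^ 5 * Q₆ ^ M
      b : ℕ → Carrier
      b i = q ^ 1 * (q ^ 2) ^ (i ℕ.+ 3 ℕ.* M)
      three-suc : ∀ M → 3 ℕ.* suc M ≡ 3 ℕ.+ 3 ℕ.* M
      three-suc = solve-∀
      six₁ : ∀ M → 1 ℕ.+ 2 ℕ.* (0 ℕ.+ 3 ℕ.* M) ≡ 1 ℕ.+ 6 ℕ.* M
      six₁ = solve-∀
      six₃ : ∀ M → 1 ℕ.+ 2 ℕ.* (1 ℕ.+ 3 ℕ.* M) ≡ 3 ℕ.+ 6 ℕ.* M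
      six₃ = solve-∀
      six₅ : ∀ M → 1 ℕ.+ 2 ℕ.* (2 ℕ.+ 3 ℕ.* M) ≡ 5 ℕ.+ 6 ℕ.* M
      six₅ = solve-∀
      exponent : ∀ e i → 1 ℕ.+ 2 ℕ.* (i ℕ.+ 3 ℕ.* M) ≡ e ℕ.+ 6 ℕ.* M → b i ≈ q ^ e * Q₆ ^ M
      exponent e i eq = trans (^-affine q 1 2 (i ℕ.+ 3 ℕ.* M)) (trans (^-≡ eq) (sym (^-affine q e 6 M)))

    lhs-as-convolution : ∀ L → lhs1p2 R L M q ≈ conv E (spread ρ) L
    lhs-as-convolution L = sym (trans (antidiagonal-Σ₀ _ L) (Σ₀-cong L summand))
      where
      guarded : ℤ → ℕ → Carrier
      guarded z m = if evenℤ z then E m * qbin R Q₆ (+ (2 ℕ.* M)) (halfℤ z) else 0#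
      summand : ∀ m → m ℕ.≤ L → E m * spread ρ (L ℕ.∸ m) ≈ guarded (+ L ℤ.- + m) m
      summand m m≤L = begin
        E m * spread ρ (L ℕ.∸ m)                                          ≈⟨ *-congˡ (spread-parity ρ (L ℕ.∸ m)) ⟩
        E m * (if evenℕ (L ℕ.∸ m) then ρ ℕ.⌊ L ℕ.∸ m /2⌋ else 0#)        ≈⟨ sym (if-*ˡ (evenℕ (L ℕ.∸ m)) _ _) ⟩
        guarded (+ (L ℕ.∸ m)) m                                           ≡⟨ ≡.cong (λ z → guarded z m) (≡.sym (Arithmetic.+-∸ L m m≤L)) ⟩
        guarded (+ L ℤ.- + m) m                                           ∎

    lhs-as-product : ∀ L → lhs1p2 R L M q ≈ product L
    lhs-as-product L = begin
      lhs1p2 R L M q                                        ≈⟨ lhs-as-convolution L ⟩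
      conv E (spread ρ) L                                   ≈⟨ conv-cong (≋-sym E-coefficients) (λ _ → refl) L ⟩
      conv (qprod (q ^ 1) (q ^ 2) (3 ℕ.* M) one) (spread ρ) L ≈⟨ sym (qprod-conv (q ^ 1) (q ^ 2) (3 ℕ.* M) (spread ρ) L) ⟩
      qprod (q ^ 1) (q ^ 2) (3 ℕ.* M) (spread ρ) L          ≈⟨ regroup M (spread ρ) L ⟩
      qprod (q ^ 3) Q₆ M (qprod (q ^ 1) Q₆ M (qprod (q ^ 5) Q₆ M (spread ρ))) L
        ≈⟨ qprod-conv (q ^ 3) Q₆ M _ L ⟩
      conv (P 3) (qprod (q ^ 1) Q₆ M (qprod (q ^ 5) Q₆ M (spread ρ))) L
        ≈⟨ conv-congʳ (P 3) (≋-trans (qprod-conv (q ^ 1) Q₆ M _) (conv-congʳ (P 1) (qprod-conv (q ^ 5) Q₆ M (spread ρ)))) L ⟩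
      product L                                             ∎

    -- With r = q³, T(L,M; j,j; q⁶) = Σ_n α n · pair (L-n) j, where
    -- α n = r^(n²) [M; n]_{r²} are the coefficients of P 3 and pair is the
    -- guarded product of the two remaining Gaussian polynomials.
    r : Carrier
    r = q ^ 3

    -- the refined trinomial coefficient is evaluated at q⁶ = r · r

    r²≈Q₆ : r * r ≈ Q₆
    r²≈Q₆ = sym (^-+ q 3 3)

    w : ℤ → Carrier
    w j = q ^ ℤ.∣ + 3 ℤ.* j ℤ.* j ℤ.+ + 2 ℤ.* j ∣

    pair : Carrier → ℤ → ℤ → Carrier
    pair Q b j = if evenℤ (b ℤ.- j) then qbin R Q (+ M ℤ.+ j) (halfℤ (b ℤ.- j)) * qbin R Q (+ M ℤ.- j) (halfℤ (b ℤ.+ j)) else 0#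

    α : Series
    α n = r ^ (n ℕ.* n) * G (r * r) M n

    -- α are the coefficients of P 3 (tri 3 n = 3n²)
    α≋P₃ : α ≋ P 3
    α≋P₃ n = trans (*-cong (trans (sym (^-* q 3 (n ℕ.* n))) (^-≡ (≡.sym (tri3 n)))) (G-cong M n r²≈Q₆))
                   (sym (P-coefficients 3 n))

    trinomial-summand : ℕ → ℤ → ℕ → Carrier
    trinomial-summand L j n =
      if evenℤ (+ L ℤ.- j ℤ.- + n)
      then r ^ (n ℕ.* n) * G (r * r) M n * qbin R (r * r) (+ M ℤ.+ j) (halfℤ (+ L ℤ.- j ℤ.- + n))
           * qbin R (r * r) (+ M ℤ.- j) (halfℤ (+ L ℤ.+ j ℤ.- + n))
      else 0#

    trinomial-summand-split : ∀ L j n → trinomial-summand L j n ≈ α n * pair (r * r) (+ L ℤ.- + n) j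
    trinomial-summand-split L j n = trans (reflexive (≡.cong₂ guarded (reorder₋ (+ L) j (+ n)) (reorder₊ (+ L) j (+ n))))
      (trans (if-cong (evenℤ ((+ L ℤ.- + n) ℤ.- j)) (*-assoc _ _ _)) (if-*ˡ (evenℤ ((+ L ℤ.- + n) ℤ.- j)) _ _))
      where
      guarded : ℤ → ℤ → Carrier
      guarded z₁ z₂ = if evenℤ z₁ then α n * qbin R (r * r) (+ M ℤ.+ j) (halfℤ z₁) * qbin R (r * r) (+ M ℤ.- j) (halfℤ z₂) else 0#
      reorder₋ : ∀ L j n → L ℤ.- j ℤ.- n ≡ (L ℤ.- n) ℤ.- j
      reorder₋ = ℤSolver.solve-∀
      reorder₊ : ∀ L j n → L ℤ.+ j ℤ.- n ≡ (L ℤ.- n) ℤ.+ j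
      reorder₊ = ℤSolver.solve-∀

    pair-cong : ∀ {Q Q′} b j → Q ≈ Q′ → pair Q b j ≈ pair Q′ b j
    pair-cong b j Q≈Q′ = if-cong (evenℤ (b ℤ.- j)) (*-cong (qbin-cong (+ M ℤ.+ j) (halfℤ (b ℤ.- j)) Q≈Q′)
                                                           (qbin-cong (+ M ℤ.- j) (halfℤ (b ℤ.+ j)) Q≈Q′))

    pair-vanish₁ : ∀ Q b j x → b ℤ.- j ≡ -[1+ x ] → pair Q b j ≈ 0#
    pair-vanish₁ Q b j x = guarded-vanish₁ Q (b ℤ.- j) x (+ M ℤ.+ j) (qbin R Q (+ M ℤ.- j) (halfℤ (b ℤ.+ j)))

    pair-vanish₂ : ∀ Q b j x → b ℤ.+ j ≡ -[1+ x ] → evenℤ (b ℤ.- j) ≡ evenℕ (suc x) → pair Q b j ≈ 0#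
    pair-vanish₂ Q b j x = guarded-vanish₂ Q (b ℤ.- j) (b ℤ.+ j) x (qbin R Q (+ M ℤ.+ j) (halfℤ (b ℤ.- j))) (+ M ℤ.- j)

    pair-negative : ∀ Q d j → pair Q -[1+ d ] j ≈ 0#
    pair-negative Q d (+ zero) = pair-vanish₁ Q -[1+ d ] (+ zero) d ≡.refl
    pair-negative Q d (+ suc m) = pair-vanish₁ Q -[1+ d ] (+ suc m) (suc (d ℕ.+ m)) ≡.refl
    pair-negative Q d -[1+ m ] = pair-vanish₂ Q -[1+ d ] -[1+ m ] (suc (d ℕ.+ m)) ≡.refl
      (≡.trans (Arithmetic.even-⊖ (suc m) (suc d)) (≡.cong (λ n → evenℕ (suc n)) (swap m d)))
      where swap : ∀ m d → m ℕ.+ suc d ≡ suc (d ℕ.+ m)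
            swap = solve-∀

    pair-above : ∀ Q k d → pair Q (+ k) (+ suc (k ℕ.+ d)) ≈ 0#
    pair-above Q k d = pair-vanish₁ Q (+ k) (+ suc (k ℕ.+ d)) d (≡.trans (ℤP.m-n≡m⊖n k (suc (k ℕ.+ d))) (Arithmetic.⊖-below k d))

    pair-below : ∀ Q k d → pair Q (+ k) -[1+ k ℕ.+ d ] ≈ 0#
    pair-below Q k d = pair-vanish₂ Q (+ k) -[1+ k ℕ.+ d ] d (Arithmetic.⊖-below k d)
                         (≡.trans (≡.cong evenℕ (reassociate k d)) (Arithmetic.even-double+ k (suc d)))
      where reassociate : ∀ k d → k ℕ.+ suc (k ℕ.+ d) ≡ k ℕ.+ k ℕ.+ suc d
            reassociate = solve-∀

    pair-odd₊ : ∀ Q k m → evenℕ (k ℕ.+ m) ≡ false → pair Q (+ k) (+ m) ≈ 0#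
    pair-odd₊ Q k m odd = if-false (evenℤ (+ k ℤ.- + m))
      (≡.trans (≡.cong evenℤ (ℤP.m-n≡m⊖n k m)) (≡.trans (Arithmetic.even-⊖ k m) odd))

    pair-odd₋ : ∀ Q k m → evenℕ (k ℕ.+ m) ≡ false → pair Q (+ k) (ℤ.- (+ m)) ≈ 0#
    pair-odd₋ Q k m odd = if-false (evenℤ (+ k ℤ.- (ℤ.- (+ m))))
      (≡.trans (≡.cong (λ z → evenℤ (+ k ℤ.+ z)) (ℤP.neg-involutive (+ m))) odd)

    -- at b = u + v, j = v - u both half-indices are integers: pair = [M+v; u][M+u; v]
    pair-diagonal : ∀ u v → pair Q₆ (+ (u ℕ.+ v)) (+ v ℤ.- + u) ≈ A M M u v
    pair-diagonal u v = begin
      pair Q₆ (+ (u ℕ.+ v)) j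
        ≡⟨ ≡.cong₂ (λ f x → f x) (≡.cong₂ guarded difference sum) (≡.cong₂ _,_ top₁ top₂) ⟩
      guarded (+ (u ℕ.+ u)) (+ (v ℕ.+ v)) (+ (M ℕ.+ v) ℤ.- + u , + (M ℕ.+ u) ℤ.- + v)
        ≈⟨ reflexive (halves (+ (M ℕ.+ v) ℤ.- + u) (+ (M ℕ.+ u) ℤ.- + v)) ⟩
      qbin R Q₆ (+ (M ℕ.+ v) ℤ.- + u) (+ u) * qbin R Q₆ (+ (M ℕ.+ u) ℤ.- + v) (+ v)
        ≈⟨ *-cong (qbin-difference Q₆ (M ℕ.+ v) u) (qbin-difference Q₆ (M ℕ.+ u) v) ⟩
      A M M u v ∎
      where
      j = + v ℤ.- + u
      guarded : ℤ → ℤ → ℤ × ℤ → Carrier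
      guarded z₁ z₂ (y₁ , y₂) = if evenℤ z₁ then qbin R Q₆ y₁ (halfℤ z₁) * qbin R Q₆ y₂ (halfℤ z₂) else 0#
      halves : ∀ y₁ y₂ → guarded (+ (u ℕ.+ u)) (+ (v ℕ.+ v)) (y₁ , y₂) ≡ qbin R Q₆ y₁ (+ u) * qbin R Q₆ y₂ (+ v)
      halves y₁ y₂ rewrite Arithmetic.even-double u | Arithmetic.half-double u | Arithmetic.half-double v = ≡.refl
      difference : + (u ℕ.+ v) ℤ.- j ≡ + (u ℕ.+ u)
      difference = ≡.trans (≡.cong (ℤ._- j) (ℤP.pos-+ u v)) (≡.trans (identity (+ u) (+ v)) (≡.sym (ℤP.pos-+ u u)))
        where identity : ∀ u v → (u ℤ.+ v) ℤ.- (v ℤ.- u) ≡ u ℤ.+ u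
              identity = ℤSolver.solve-∀
      sum : + (u ℕ.+ v) ℤ.+ j ≡ + (v ℕ.+ v)
      sum = ≡.trans (≡.cong (ℤ._+ j) (ℤP.pos-+ u v)) (≡.trans (identity (+ u) (+ v)) (≡.sym (ℤP.pos-+ v v)))
        where identity : ∀ u v → (u ℤ.+ v) ℤ.+ (v ℤ.- u) ≡ v ℤ.+ v
              identity = ℤSolver.solve-∀
      top₁ : + M ℤ.+ j ≡ + (M ℕ.+ v) ℤ.- + u
      top₁ = ≡.trans (identity (+ M) (+ u) (+ v)) (≡.cong (ℤ._- + u) (≡.sym (ℤP.pos-+ M v)))
        where identity : ∀ m u v → m ℤ.+ (v ℤ.- u) ≡ (m ℤ.+ v) ℤ.- u
              identity = ℤSolver.solve-∀
      top₂ : + M ℤ.- j ≡ + (M ℕ.+ u) ℤ.- + v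
      top₂ = ≡.trans (identity (+ M) (+ u) (+ v)) (≡.cong (ℤ._- + v) (≡.sym (ℤP.pos-+ M u)))
        where identity : ∀ m u v → m ℤ.- (v ℤ.- u) ≡ (m ℤ.+ u) ℤ.- v
              identity = ℤSolver.solve-∀

    -- D t = Σ_{u+v=t} q^(3j²+2j) [M+v; u][M+u; v]_{q⁶}  with j = v - u
    D : Series
    D = antidiagonal (λ u v → q ^ weight u v * A M M u v)

    -- for b = k ≥ 0 the j-sum keeps only j = v - u with u + v = k
    j-sum : ∀ k d → Σ± (k ℕ.+ d) (λ j → w j * pair Q₆ (+ k) j) ≈ D k
    j-sum k d = begin
      Σ± (k ℕ.+ d) C
        ≈⟨ Σ±-extend k C (λ d → *-vanishʳ (pair-above Q₆ k d)) (λ d → *-vanishʳ (pair-below Q₆ k d)) d ⟩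
      Σ± k C
        ≈⟨ Σ±-parity k C (λ m odd → *-vanishʳ (pair-odd₊ Q₆ k m odd) , *-vanishʳ (pair-odd₋ Q₆ k m odd)) ⟩
      Σ₀ k (λ u → C (+ (k ℕ.∸ u) ℤ.- + u))                      ≈⟨ Σ₀-cong k summand ⟩
      Σ₀ k (λ u → q ^ weight u (k ℕ.∸ u) * A M M u (k ℕ.∸ u))   ≈⟨ sym (antidiagonal-Σ₀ _ k) ⟩
      D k                                                         ∎
      where
      C : ℤ → Carrier
      C j = w j * pair Q₆ (+ k) j
      summand : ∀ u → u ℕ.≤ k → C (+ (k ℕ.∸ u) ℤ.- + u) ≈ q ^ weight u (k ℕ.∸ u) * A M M u (k ℕ.∸ u)
      summand u u≤k = *-cong (^-≡ (weight-abs u (k ℕ.∸ u)))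
        (trans (reflexive (≡.cong (λ b → pair Q₆ (+ b) (+ (k ℕ.∸ u) ℤ.- + u)) (≡.sym (ℕP.m+[n∸m]≡n u≤k))))
               (pair-diagonal u (k ℕ.∸ u)))

    -- the product formula turns D into P 1 · P 5 · ρ(z²)
    D-product : D ≋ conv (P 1) (conv (P 5) (spread ρ))
    D-product t = begin
      D t
        ≈⟨ antidiagonal-cong (λ u v → *-congˡ (product-formula Q₆ M M u v)) t ⟩
      antidiagonal (λ u v → q ^ weight u v * diag (term M M (M ℕ.+ M)) u v) t
        ≈⟨ antidiagonal-cong (λ u v → diag-weight (λ a b → q ^ weight a b) (λ _ _ → refl) _ u v) t ⟩
      antidiagonal (λ u v → diag (λ a b k → q ^ weight a b * term M M (M ℕ.+ M) a b k) u v) t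
        ≈⟨ antidiagonal-cong (λ u v → diag-cong separate u v) t ⟩
      antidiagonal (λ u v → diag (λ a b k → p₁ a * p₅ b * ρ′ k) u v) t
        ≈⟨ antidiagonal-of-diag p₁ p₅ ρ′ t ⟩
      conv p₁ (conv p₅ (spread ρ′)) t
        ≈⟨ conv-cong (≋-sym (P-coefficients 1)) (conv-cong (≋-sym (P-coefficients 5)) (spread-cong ρ′≋ρ)) t ⟩
      conv (P 1) (conv (P 5) (spread ρ)) t ∎
      where
      p₁ p₅ ρ′ : Series
      p₁ a = q ^ tri 1 a * G Q₆ M a
      p₅ b = q ^ tri 5 b * G Q₆ M b
      ρ′ k = G Q₆ (M ℕ.+ M ℕ.+ k) k
      ρ′≋ρ : ρ′ ≋ ρ
      ρ′≋ρ k = trans (G-≡ k (≡.cong (λ n → n ℕ.+ k) (≡.sym two))) (sym (G-sym Q₆ (2 ℕ.* M) k))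
        where two : 2 ℕ.* M ≡ M ℕ.+ M
              two = ≡.cong (λ n → M ℕ.+ n) (ℕP.+-identityʳ M)
      weight-factor : ∀ a b → q ^ weight a b * Q₆ ^ (a ℕ.* b) ≈ q ^ tri 1 a * q ^ tri 5 b
      weight-factor a b = begin
        q ^ weight a b * Q₆ ^ (a ℕ.* b)           ≈⟨ *-congˡ (sym (^-* q 6 (a ℕ.* b))) ⟩
        q ^ weight a b * q ^ (6 ℕ.* (a ℕ.* b))    ≈⟨ sym (^-+ q (weight a b) (6 ℕ.* (a ℕ.* b))) ⟩
        q ^ (weight a b ℕ.+ 6 ℕ.* (a ℕ.* b))      ≈⟨ ^-≡ (weight-split a b) ⟩
        q ^ (tri 1 a ℕ.+ tri 5 b)                 ≈⟨ ^-+ q (tri 1 a) (tri 5 b) ⟩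
        q ^ tri 1 a * q ^ tri 5 b                 ∎
      separate : ∀ a b k → q ^ weight a b * term M M (M ℕ.+ M) a b k ≈ p₁ a * p₅ b * ρ′ k
      separate a b k = begin
        q ^ weight a b * (Q₆ ^ (a ℕ.* b) * G Q₆ M a * G Q₆ M b * ρ′ k)
          ≈⟨ solve 5 (λ e p x y g → e :* (p :* x :* y :* g) := (e :* p) :* x :* y :* g) refl _ _ _ _ _ ⟩
        (q ^ weight a b * Q₆ ^ (a ℕ.* b)) * G Q₆ M a * G Q₆ M b * ρ′ k ≈⟨ *-congʳ (*-congʳ (*-congʳ (weight-factor a b))) ⟩
        (q ^ tri 1 a * q ^ tri 5 b) * G Q₆ M a * G Q₆ M b * ρ′ k
          ≈⟨ solve 5 (λ x₁ x₅ x y g → (x₁ :* x₅) :* x :* y :* g := (x₁ :* x) :* (x₅ :* y) :* g) refl _ _ _ _ _ ⟩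
        p₁ a * p₅ b * ρ′ k ∎

    rhs-term : ℕ → Series
    rhs-term L n = α n * Σ± (L ℕ.+ M) (λ j → w j * pair (r * r) (+ L ℤ.- + n) j)

    rhs-exchange : ∀ L → rhs1p2 R L M q ≈ Σ₀ M (rhs-term L)
    rhs-exchange L = begin
      rhs1p2 R L M q                                                      ≈⟨ Σ±-cong (L ℕ.+ M) (λ j → Σ₀-*ˡ M (w j) _) ⟩
      Σ± (L ℕ.+ M) (λ j → Σ₀ M (λ n → w j * trinomial-summand L j n))   ≈⟨ Σ±-Σ₀-swap (L ℕ.+ M) M _ ⟩
      Σ₀ M (λ n → Σ± (L ℕ.+ M) (λ j → w j * trinomial-summand L j n))   ≈⟨ Σ₀-cong M (λ n _ → factor-α n) ⟩
      Σ₀ M (rhs-term L)                                                   ∎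
      where
      factor-α : ∀ n → Σ± (L ℕ.+ M) (λ j → w j * trinomial-summand L j n) ≈ rhs-term L n
      factor-α n = trans
        (Σ±-cong (L ℕ.+ M) (λ j → trans (*-congˡ (trinomial-summand-split L j n))
                                         (solve 3 (λ a b c → a :* (b :* c) := b :* (a :* c)) refl _ _ _)))
        (sym (Σ±-*ˡ (L ℕ.+ M) (α n) _))

    -- rhs-term L n vanishes for n > M ([M; n] = 0) and for n > L (pair at negative b)
    rhs-term-above-M : ∀ L n → M ℕ.< n → rhs-term L n ≈ 0#
    rhs-term-above-M L n M<n = *-vanishˡ (*-vanishʳ (G-vanish (r * r) M n M<n))

    rhs-term-above-L : ∀ L n → L ℕ.< n → rhs-term L n ≈ 0#
    rhs-term-above-L L n L<n = *-vanishʳ (Σ±-vanish (L ℕ.+ M) _ (λ j →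
      *-vanishʳ (trans (reflexive (≡.cong (λ b → pair (r * r) b j) negative)) (pair-negative (r * r) _ j))))
      where negative : + L ℤ.- + n ≡ -[1+ n ℕ.∸ suc L ]
            negative = ≡.trans (ℤP.m-n≡m⊖n L n)
              (≡.trans (≡.cong (λ m → L ⊖ m) (≡.sym (ℕP.m+[n∸m]≡n L<n))) (Arithmetic.⊖-below L (n ℕ.∸ suc L)))

    rhs-term-convolution : ∀ L n → n ℕ.≤ L → rhs-term L n ≈ P 3 n * D (L ℕ.∸ n)
    rhs-term-convolution L n n≤L = *-cong (α≋P₃ n) (begin
      Σ± (L ℕ.+ M) (λ j → w j * pair (r * r) (+ L ℤ.- + n) j)
        ≈⟨ Σ±-cong (L ℕ.+ M) (λ j → *-congˡ (trans (reflexive (≡.cong (λ b → pair (r * r) b j) (Arithmetic.+-∸ L n n≤L)))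
                                                     (pair-cong (+ (L ℕ.∸ n)) j r²≈Q₆))) ⟩
      Σ± (L ℕ.+ M) (λ j → w j * pair Q₆ (+ (L ℕ.∸ n)) j)                ≈⟨ Σ±-≡ _ (≡.sym total) ⟩
      Σ± (L ℕ.∸ n ℕ.+ (n ℕ.+ M)) (λ j → w j * pair Q₆ (+ (L ℕ.∸ n)) j)  ≈⟨ j-sum (L ℕ.∸ n) (n ℕ.+ M) ⟩
      D (L ℕ.∸ n)                                                         ∎)
      where total : L ℕ.∸ n ℕ.+ (n ℕ.+ M) ≡ L ℕ.+ M
            total = ≡.trans (≡.sym (ℕP.+-assoc (L ℕ.∸ n) n M)) (≡.cong (λ m → m ℕ.+ M) (ℕP.m∸n+n≡m n≤L))

    rhs-as-product : ∀ L → rhs1p2 R L M q ≈ product L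
    rhs-as-product L = begin
      rhs1p2 R L M q                   ≈⟨ rhs-exchange L ⟩
      Σ₀ M (rhs-term L)                ≈⟨ sym (Σ₀-extend M (rhs-term L) (rhs-term-above-M L) L) ⟩
      Σ₀ (M ℕ.+ L) (rhs-term L)        ≈⟨ Σ₀-≡ (rhs-term L) (ℕP.+-comm M L) ⟩
      Σ₀ (L ℕ.+ M) (rhs-term L)        ≈⟨ Σ₀-extend L (rhs-term L) (rhs-term-above-L L) M ⟩
      Σ₀ L (rhs-term L)                ≈⟨ Σ₀-cong L (rhs-term-convolution L) ⟩
      Σ₀ L (λ n → P 3 n * D (L ℕ.∸ n)) ≈⟨ sym (antidiagonal-Σ₀ _ L) ⟩
      conv (P 3) D L                   ≈⟨ conv-congʳ (P 3) D-product L ⟩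
      product L                        ∎

theorem1p2 : ∀ {c ℓ} (R : CommutativeRing c ℓ) (q : CommutativeRing.Carrier R) (L M : ℕ) →
    CommutativeRing._≈_ R (lhs1p2 R L M q) (rhs1p2 R L M q)
theorem1p2 R q L M = CommutativeRing.trans R (Identity.lhs-as-product R q M L) (CommutativeRing.sym R (Identity.rhs-as-product R q M L))
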